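{- For every positive integer $n$: if $n$ is odd then $a_2(n)=\frac{(n-1)^2(n+1)(n+3)}{32}$, and if $n$ is even then $a_2(n)=\frac{n(n-2)(n+2)^2}{32}$.
   Context: For a positive integer $n$, $T_n$ denotes the triangular lattice with $n$ rows: the set of points $\{a(1,0)+b(\tfrac12,\tfrac{\sqrt3}{2}) : a,b\in\mathbb{Z}_{\ge 0},\ a+b\le n-1\}$ in the plane. For an unordered pair $\{p_1,p_2\}$ of distinct points of $T_n$, the number of points $p_3\in T_n$ such that $p_1,p_2,p_3$ are the vertices of an equilateral triangle is $0$, $1$ or $2$. For $i\in\{0,1,2\}$, $a_i(n)$ denotes the number of unordered pairs of distinct points of $T_n$ for which this number equals $i$. -}

module Defs where

open import Data.Nat using (ℕ; zero; suc; _∸_)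
open import Data.Integer as ℤ using (ℤ; +_)
import Data.Integer.Properties as ℤP
open import Data.List using (List; []; _∷_; map; _++_; concatMap; upTo; filter; length)
open import Data.Product using (_×_; _,_)
open import Relation.Nullary using (Dec; ¬_)
open import Relation.Nullary.Decidable using (_×-dec_; ¬?)
open import Relation.Binary.PropositionalEquality using (_≡_)
import Data.Nat.Properties as ℕP

-- A point a(1,0) + b(1/2, √3/2) of the plane is represented by its
-- lattice coordinates (a , b).
Point : Set
Point = ℕ × ℕ

T : ℕ → List Point
T n = concatMap (λ a → map (λ b → (a , b)) (upTo (n ∸ a))) (upTo n)

-- Squared Euclidean distance between two points: for the difference vector
-- x(1,0) + y(1/2,√3/2) the squared length is x² + xy + y².
dist² : Point → Point → ℤ
dist² (a₁ , b₁) (a₂ , b₂) =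
  let x = (+ a₁) ℤ.- (+ a₂)
      y = (+ b₁) ℤ.- (+ b₂)
  in x ℤ.* x ℤ.+ x ℤ.* y ℤ.+ y ℤ.* y

Equilateral : Point → Point → Point → Set
Equilateral p₁ p₂ p₃ =
  (¬ dist² p₁ p₂ ≡ + 0) × (dist² p₁ p₂ ≡ dist² p₂ p₃) × (dist² p₁ p₂ ≡ dist² p₁ p₃)

equilateral? : ∀ p₁ p₂ p₃ → Dec (Equilateral p₁ p₂ p₃)
equilateral? p₁ p₂ p₃ =
  ¬? (dist² p₁ p₂ ℤ.≟ + 0)
    ×-dec (dist² p₁ p₂ ℤ.≟ dist² p₂ p₃)
    ×-dec (dist² p₁ p₂ ℤ.≟ dist² p₁ p₃)

pairs : {A : Set} → List A → List (A × A)
pairs [] = []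
pairs (x ∷ xs) = map (λ y → (x , y)) xs ++ pairs xs

thirdVertices : ℕ → Point × Point → ℕ
thirdVertices n (p₁ , p₂) = length (filter (equilateral? p₁ p₂) (T n))

a : ℕ → ℕ → ℕ
a i n = length (filter (λ pr → thirdVertices n pr ℕP.≟ i) (pairs (T n)))

{-# OPTIONS --safe #-}

-- In lattice coordinates the rotation by 60° is ρ (x , y) = (- y , x + y) and
-- dist² is the norm form Q x y = x² + x y + y².  For p ≠ q the only third
-- vertices are p + ρ (q - p) and q + ρ (p - q): if Q v = Q (v - x) = Q x ≠ 0,
-- Lagrange's identity 4 Q x Q v = B² + 3 D² (B the polar form, D the
-- determinant of x and v) forces D = ± Q x, which fixes v.  So a pair counts
-- for a₂ iff both rotations of q about p by ±60° lie in T_n.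
-- Sort the ordered pairs by the direction of q - p into the six sectors
-- ± ρᵏ {(x , y) | x ≥ 1 , y ≥ 0}; swapping p and q exchanges opposite sectors,
-- so a₂ counts the pairs with k = 0, 1, 2.  For q - p = ρᵏ (1 + i , j) the
-- admissible p form a translated copy of T_{n - 2 (1 + i + j)}, whence
-- a₂ n = 3 ∑_{i,j} tri (n - 2 (1 + i + j)); summing tri along the parity class
-- of n twice gives the two quartic closed forms.
module Submission where

open import Defs
open import Data.Product using (_×_; _,_; proj₁; proj₂)
open import Data.Sum as Sum using (_⊎_; inj₁; inj₂; [_,_]′)
open import Function using (id; _∘_; _⇔_; mk⇔; Equivalence)
open import Relation.Nullary using (¬_; Dec; yes; no; does; contradiction)
open import Relation.Binary.PropositionalEquality
open ≡-Reasoning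
import Data.Nat as ℕ

infix 4 _≡_⊖_

_≡_⊖_ : ℕ.ℕ → ℕ.ℕ → ℕ.ℕ → Set
x ≡ β ⊖ α = β ≡ x ℕ.+ α

module ThirdVertex where

  open import Data.Integer using (ℤ; +_; -[1+_]; 0ℤ; _+_; _-_; _*_; -_; ∣_∣; ≢-nonZero)
  open import Data.Integer.Properties
    using (pos-+; pos-*; +-injective; i*j≡0⇒i≡0∨j≡0; i*j≢0; i-j≡0⇒i≡j; i≡j⇒i-j≡0; +-inverseʳ; *-cancelˡ-≡)
  open import Data.Integer.Solver using (module +-*-Solver)
  open import Data.Integer.Tactic.RingSolver using (solve-∀)
  import Data.Nat.Properties as ℕₚ
  open import Data.Product.Function.NonDependent.Propositional using (_×-⇔_)
  open +-*-Solver using (solve; _:=_; _:+_; _:-_; _:*_; :-_; con; Polynomial)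

  Q : ℤ → ℤ → ℤ
  Q x y = x * x + x * y + y * y

  -- Q as a polynomial of the non-reflective solver, so that identities can be
  -- stated in terms of Q; the reflective solver does not unfold Q.
  private
    Qₚ : ∀ {n} → Polynomial n → Polynomial n → Polynomial n
    Qₚ x y = x :* x :+ x :* y :+ y :* y

  Q-comm : ∀ x y → Q x y ≡ Q y x
  Q-comm = solve 2 (λ x y → Qₚ x y := Qₚ y x) refl

  Q-rotate : ∀ x y → Q (- y) (x + y) ≡ Q x y
  Q-rotate = solve 2 (λ x y → Qₚ (:- y) (x :+ y) := Qₚ x y) refl

  Q-rotate-sub : ∀ x y → Q (- y - x) (x + y - y) ≡ Q x y
  Q-rotate-sub = solve 2 (λ x y → Qₚ (:- y :- x) (x :+ y :- y) := Qₚ x y) refl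

  three-Q : ∀ x y → let α = x + + 2 * y; β = + 2 * x + y in + 3 * Q x y ≡ α * α + β * β - α * β
  three-Q = solve 2 (λ x y → let α = x :+ con (+ 2) :* y; β = con (+ 2) :* x :+ y in
                             con (+ 3) :* Qₚ x y := α :* α :+ β :* β :- α :* β) refl

  i*i≡∣i∣*∣i∣ : ∀ i → i * i ≡ + (∣ i ∣ ℕ.* ∣ i ∣)
  i*i≡∣i∣*∣i∣ (+ n) = sym (pos-* n n)
  i*i≡∣i∣*∣i∣ -[1+ n ] = refl

  i*i≡0⇒i≡0 : ∀ i → i * i ≡ 0ℤ → i ≡ 0ℤ
  i*i≡0⇒i≡0 i eq = [ id , id ]′ (i*j≡0⇒i≡0∨j≡0 i eq)

  Q≡0⇒y≡0 : ∀ x y → Q x y ≡ 0ℤ → y ≡ 0ℤ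
  Q≡0⇒y≡0 x y Q≡0 = i*i≡0⇒i≡0 y (trans (i*i≡∣i∣*∣i∣ y) (cong +_ t≡0))
    where
    s = ∣ + 2 * x + y ∣ ℕ.* ∣ + 2 * x + y ∣
    t = ∣ y ∣ ℕ.* ∣ y ∣
    four-Q : + 4 * Q x y ≡ (+ 2 * x + y) * (+ 2 * x + y) + + 3 * (y * y)
    four-Q = solve 2 (λ x y → con (+ 4) :* Qₚ x y
                            := (con (+ 2) :* x :+ y) :* (con (+ 2) :* x :+ y) :+ con (+ 3) :* (y :* y)) refl x y
    s+3t≡0 : s ℕ.+ 3 ℕ.* t ≡ 0
    s+3t≡0 = +-injective (begin
      + (s ℕ.+ 3 ℕ.* t)
        ≡⟨ trans (pos-+ s (3 ℕ.* t)) (cong (_+_ (+ s)) (pos-* 3 t)) ⟩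
      + s + + 3 * + t
        ≡⟨ cong₂ (λ u v → u + + 3 * v) (sym (i*i≡∣i∣*∣i∣ (+ 2 * x + y))) (sym (i*i≡∣i∣*∣i∣ y)) ⟩
      (+ 2 * x + y) * (+ 2 * x + y) + + 3 * (y * y) ≡⟨ sym four-Q ⟩
      + 4 * Q x y                                   ≡⟨ cong (+ 4 *_) Q≡0 ⟩
      0ℤ                                            ∎)
    t≡0 : t ≡ 0
    t≡0 = [ (λ ()) , id ]′ (ℕₚ.m*n≡0⇒m≡0∨n≡0 3 (ℕₚ.m+n≡0⇒n≡0 s s+3t≡0))

  Q≡0⇒≡0 : ∀ x y → Q x y ≡ 0ℤ → x ≡ 0ℤ × y ≡ 0ℤ
  Q≡0⇒≡0 x y Q≡0 = Q≡0⇒y≡0 y x (trans (Q-comm y x) Q≡0) , Q≡0⇒y≡0 x y Q≡0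

  dist²-comm : ∀ {a b c d} → dist² (a , b) (c , d) ≡ dist² (c , d) (a , b)
  dist²-comm {a} {b} {c} {d} =
    solve 4 (λ a b c d → Qₚ (a :- c) (b :- d) := Qₚ (c :- a) (d :- b)) refl (+ a) (+ b) (+ c) (+ d)

  -- The hypotheses give B = Q x, Lagrange's identity then D = ± Q x, and
  -- Cramer's rule for the linear system (B , D) in v determines v.
  module _ (x y v w : ℤ) (Qx≢0 : Q x y ≢ 0ℤ) (Qv≡Qx : Q v w ≡ Q x y) (Qv-x≡Qx : Q (v - x) (w - y) ≡ Q x y)
    where
    private
      q = Q x y
      B = + 2 * x * v + x * w + y * v + + 2 * y * w
      D = x * w - y * v

      Bₚ Dₚ : ∀ {n} → Polynomial n → Polynomial n → Polynomial n → Polynomial n → Polynomial n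
      Bₚ x y v w = con (+ 2) :* x :* v :+ x :* w :+ y :* v :+ con (+ 2) :* y :* w
      Dₚ x y v w = x :* w :- y :* v

      polar : B ≡ Q v w + Q x y - Q (v - x) (w - y)
      polar = solve 4 (λ x y v w → Bₚ x y v w := Qₚ v w :+ Qₚ x y :- Qₚ (v :- x) (w :- y)) refl x y v w

      lagrange : + 4 * Q x y * Q v w ≡ B * B + + 3 * (D * D)
      lagrange = solve 4 (λ x y v w → con (+ 4) :* Qₚ x y :* Qₚ v w
                                    := Bₚ x y v w :* Bₚ x y v w :+ con (+ 3) :* (Dₚ x y v w :* Dₚ x y v w)) refl x y v w

      cramer-v : + 2 * q * v ≡ x * B - (x + + 2 * y) * D
      cramer-v = solve 4 (λ x y v w → con (+ 2) :* Qₚ x y :* v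
                                    := x :* Bₚ x y v w :- (x :+ con (+ 2) :* y) :* Dₚ x y v w) refl x y v w

      cramer-w : + 2 * q * w ≡ y * B + (+ 2 * x + y) * D
      cramer-w = solve 4 (λ x y v w → con (+ 2) :* Qₚ x y :* w
                                    := y :* Bₚ x y v w :+ (con (+ 2) :* x :+ y) :* Dₚ x y v w) refl x y v w

      B≡q : B ≡ q
      B≡q = begin
        B                                 ≡⟨ polar ⟩
        Q v w + q - Q (v - x) (w - y)     ≡⟨ cong₂ (λ s t → s + q - t) Qv≡Qx Qv-x≡Qx ⟩
        q + q - q                         ≡⟨ cancel q ⟩
        q                                 ∎
        where cancel : ∀ q → q + q - q ≡ q
              cancel = solve-∀

      D²≡q² : + 3 * ((q - D) * (q + D)) ≡ 0ℤ
      D²≡q² = begin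
        + 3 * ((q - D) * (q + D))                    ≡⟨ expand q D ⟩
        + 4 * q * q - (q * q + + 3 * (D * D))
          ≡⟨ cong₂ (λ s b → + 4 * q * s - (b * b + + 3 * (D * D))) (sym Qv≡Qx) (sym B≡q) ⟩
        + 4 * q * Q v w - (B * B + + 3 * (D * D))    ≡⟨ cong (_- (B * B + + 3 * (D * D))) lagrange ⟩
        B * B + + 3 * (D * D) - (B * B + + 3 * (D * D)) ≡⟨ +-inverseʳ (B * B + + 3 * (D * D)) ⟩
        0ℤ                                           ∎
        where expand : ∀ q D → + 3 * ((q - D) * (q + D)) ≡ + 4 * q * q - (q * q + + 3 * (D * D))
              expand = solve-∀

      cancel-2q : ∀ {i j} → + 2 * q * i ≡ + 2 * q * j → i ≡ j
      cancel-2q {i} {j} = *-cancelˡ-≡ (+ 2 * q) i j {{i*j≢0 (+ 2) q {{_}} {{≢-nonZero Qx≢0}}}}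

      v-from : ∀ {i} → x * q - (x + + 2 * y) * D ≡ + 2 * q * i → v ≡ i
      v-from eq = cancel-2q (trans cramer-v (trans (cong (λ b → x * b - (x + + 2 * y) * D) B≡q) eq))

      w-from : ∀ {i} → y * q + (+ 2 * x + y) * D ≡ + 2 * q * i → w ≡ i
      w-from eq = cancel-2q (trans cramer-w (trans (cong (λ b → y * b + (+ 2 * x + y) * D) B≡q) eq))

      turn⁺ : D ≡ q → v ≡ - y × w ≡ x + y
      turn⁺ D≡q = v-from (trans (cong (λ d → x * q - (x + + 2 * y) * d) D≡q) (r x y q))
                , w-from (trans (cong (λ d → y * q + (+ 2 * x + y) * d) D≡q) (r′ x y q))
        where r : ∀ x y q → x * q - (x + + 2 * y) * q ≡ + 2 * q * (- y)
              r = solve-∀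
              r′ : ∀ x y q → y * q + (+ 2 * x + y) * q ≡ + 2 * q * (x + y)
              r′ = solve-∀

      turn⁻ : D ≡ - q → v ≡ x + y × w ≡ - x
      turn⁻ D≡-q = v-from (trans (cong (λ d → x * q - (x + + 2 * y) * d) D≡-q) (r x y q))
                 , w-from (trans (cong (λ d → y * q + (+ 2 * x + y) * d) D≡-q) (r′ x y q))
        where r : ∀ x y q → x * q - (x + + 2 * y) * (- q) ≡ + 2 * q * (x + y)
              r = solve-∀
              r′ : ∀ x y q → y * q + (+ 2 * x + y) * (- q) ≡ + 2 * q * (- x)
              r′ = solve-∀

      q²-D²≡0 : (q - D) * (q + D) ≡ 0ℤ
      q²-D²≡0 = [ (λ ()) , id ]′ (i*j≡0⇒i≡0∨j≡0 (+ 3) D²≡q²)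

      D≡±q : q - D ≡ 0ℤ ⊎ q + D ≡ 0ℤ → (v ≡ - y × w ≡ x + y) ⊎ (v ≡ x + y × w ≡ - x)
      D≡±q (inj₁ q-D≡0) = inj₁ (turn⁺ (sym (i-j≡0⇒i≡j q D q-D≡0)))
      D≡±q (inj₂ q+D≡0) = inj₂ (turn⁻ (i-j≡0⇒i≡j D (- q) (trans (r q D) q+D≡0)))
        where r : ∀ q D → D - - q ≡ q + D
              r = solve-∀

    rotation-of-equal-norms : (v ≡ - y × w ≡ x + y) ⊎ (v ≡ x + y × w ≡ - x)
    rotation-of-equal-norms = D≡±q (i*j≡0⇒i≡0∨j≡0 (q - D) q²-D²≡0)

  -- r = p + ρ (q - p) for the rotation ρ (x , y) = (- y , x + y) by 60° in
  -- lattice coordinates, written without subtraction.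
  Apex : Point → Point → Point → Set
  Apex (a , b) (c , d) (e , f) = e ≡ a ℕ.+ b ⊖ d × f ≡ c ℕ.+ d ⊖ a

  private
    ≡-by-difference : ∀ {L R S T} → L - R ≡ S - T → L ≡ R → S ≡ T
    ≡-by-difference {L} {R} {S} {T} eq L≡R = i-j≡0⇒i≡j S T (trans (sym eq) (i≡j⇒i-j≡0 L≡R))

    ℕ-equation⇔ : ∀ {m₁ m₂ n₁ n₂ S T} → (+ m₁ + + m₂) - (+ n₁ + + n₂) ≡ S - T →
                  (m₁ ℕ.+ m₂ ≡ n₁ ℕ.+ n₂) ⇔ (S ≡ T)
    ℕ-equation⇔ {m₁} {m₂} {n₁} {n₂} eq = mk⇔
      (λ m≡n → ≡-by-difference eq (trans (sym (pos-+ m₁ m₂)) (trans (cong +_ m≡n) (pos-+ n₁ n₂))))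
      (λ S≡T → +-injective (trans (pos-+ m₁ m₂) (trans (≡-by-difference (sym eq) S≡T) (sym (pos-+ n₁ n₂)))))

    Q≡0⇒≡ : ∀ {a b c d} → Q (+ a - + c) (+ b - + d) ≡ 0ℤ → (a , b) ≡ (c , d)
    Q≡0⇒≡ {a} {b} {c} {d} Q≡0 with Q≡0⇒≡0 (+ a - + c) (+ b - + d) Q≡0
    ... | x≡0 , y≡0 = cong₂ _,_ (+-injective (i-j≡0⇒i≡j (+ a) (+ c) x≡0)) (+-injective (i-j≡0⇒i≡j (+ b) (+ d) y≡0))

  module Relative (a b c d e f : ℕ.ℕ) where
    private
      p q r : Point
      p = a , b
      q = c , d
      r = e , f
      x = + a - + c
      y = + b - + d
      v = + a - + e
      w = + b - + f

    dist²-as-difference : dist² q r ≡ Q (v - x) (w - y)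
    dist²-as-difference = cong₂ Q (sub (+ a) (+ c) (+ e)) (sub (+ b) (+ d) (+ f))
      where sub : ∀ a c e → c - e ≡ (a - e) - (a - c)
            sub = solve-∀

    apex⇔rotation : Apex p q r ⇔ (v ≡ - y × w ≡ x + y)
    apex⇔rotation = ℕ-equation⇔ {a} {b} {e} {d} (r₁ (+ a) (+ b) (+ d) (+ e))
                ×-⇔ ℕ-equation⇔ {c} {d} {f} {a} (r₂ (+ a) (+ b) (+ c) (+ d) (+ f))
      where r₁ : ∀ a b d e → (a + b) - (e + d) ≡ (a - e) - - (b - d)
            r₁ = solve-∀
            r₂ : ∀ a b c d f → (c + d) - (f + a) ≡ (b - f) - ((a - c) + (b - d))
            r₂ = solve-∀

    apex⇔rotation⁻¹ : Apex q p r ⇔ (v ≡ x + y × w ≡ - x)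
    apex⇔rotation⁻¹ = ℕ-equation⇔ {c} {d} {e} {b} (r₁ (+ a) (+ b) (+ c) (+ d) (+ e))
                  ×-⇔ ℕ-equation⇔ {a} {b} {f} {c} (r₂ (+ a) (+ b) (+ c) (+ f))
      where r₁ : ∀ a b c d e → (c + d) - (e + b) ≡ (a - e) - ((a - c) + (b - d))
            r₁ = solve-∀
            r₂ : ∀ a b c f → (a + b) - (f + c) ≡ (b - f) - - (a - c)
            r₂ = solve-∀

    equilateral⇒apex : Equilateral p q r → Apex p q r ⊎ Apex q p r
    equilateral⇒apex (pq≢0 , pq≡qr , pq≡pr) =
      Sum.map (Equivalence.from apex⇔rotation) (Equivalence.from apex⇔rotation⁻¹)
        (rotation-of-equal-norms x y v w pq≢0 (sym pq≡pr) (trans (sym dist²-as-difference) (sym pq≡qr)))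

    apex⇒equilateral : p ≢ q → Apex p q r → Equilateral p q r
    apex⇒equilateral p≢q apex = (p≢q ∘ Q≡0⇒≡) , sym Q[v-x]≡Qx , sym Qv≡Qx
      where
      v≡-y = proj₁ (Equivalence.to apex⇔rotation apex)
      w≡x+y = proj₂ (Equivalence.to apex⇔rotation apex)
      Qv≡Qx : Q v w ≡ Q x y
      Qv≡Qx = trans (cong₂ Q v≡-y w≡x+y) (Q-rotate x y)
      Q[v-x]≡Qx : dist² q r ≡ Q x y
      Q[v-x]≡Qx = trans dist²-as-difference
                        (trans (cong₂ (λ s t → Q (s - x) (t - y)) v≡-y w≡x+y) (Q-rotate-sub x y))

    apex-exclusive : Apex p q r → Apex q p r → p ≡ q
    apex-exclusive apex apex′ = Q≡0⇒≡ ([ (λ ()) , id ]′ (i*j≡0⇒i≡0∨j≡0 (+ 3) 3Q≡0))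
      where
      v≡-y = proj₁ (Equivalence.to apex⇔rotation apex)
      w≡x+y = proj₂ (Equivalence.to apex⇔rotation apex)
      v≡x+y = proj₁ (Equivalence.to apex⇔rotation⁻¹ apex′)
      w≡-x = proj₂ (Equivalence.to apex⇔rotation⁻¹ apex′)
      α≡0 : x + + 2 * y ≡ 0ℤ
      α≡0 = ≡-by-difference (ring x y) (trans (sym v≡x+y) v≡-y)
        where ring : ∀ x y → (x + y) - (- y) ≡ (x + + 2 * y) - 0ℤ
              ring = solve-∀
      β≡0 : + 2 * x + y ≡ 0ℤ
      β≡0 = ≡-by-difference (ring x y) (trans (sym w≡x+y) w≡-x)
        where ring : ∀ x y → (x + y) - (- x) ≡ (+ 2 * x + y) - 0ℤ
              ring = solve-∀
      3Q≡0 : + 3 * Q x y ≡ 0ℤ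
      3Q≡0 = trans (three-Q x y) (cong₂ (λ α β → α * α + β * β - α * β) α≡0 β≡0)

  equilateral-swap : ∀ {p q r} → Equilateral p q r → Equilateral q p r
  equilateral-swap {a , b} {c , d} (pq≢0 , pq≡qr , pq≡pr) =
    pq≢0 ∘ trans (dist²-comm {a} {b} {c} {d}) , trans (sym (dist²-comm {a} {b})) pq≡pr ,
    trans (sym (dist²-comm {a} {b})) pq≡qr

  ¬equilateral-diagonal : ∀ {p r} → ¬ Equilateral p p r
  ¬equilateral-diagonal {a , b} (pp≢0 , _) = pp≢0 (cong₂ Q (+-inverseʳ (+ a)) (+-inverseʳ (+ b)))

  equilateral⇔apex : ∀ {p q r} → p ≢ q → Equilateral p q r ⇔ (Apex p q r ⊎ Apex q p r)
  equilateral⇔apex {a , b} {c , d} {e , f} p≢q = mk⇔ (Relative.equilateral⇒apex a b c d e f)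
    [ Relative.apex⇒equilateral a b c d e f p≢q
    , equilateral-swap {c , d} {a , b} {e , f} ∘ Relative.apex⇒equilateral c d a b e f (p≢q ∘ sym) ]′

  apex-exclusive : ∀ {p q r} → Apex p q r → Apex q p r → p ≡ q
  apex-exclusive {a , b} {c , d} {e , f} = Relative.apex-exclusive a b c d e f

open ThirdVertex using (Apex; equilateral⇔apex; apex-exclusive; equilateral-swap; ¬equilateral-diagonal)

open import Data.Nat.Properties
open import Algebra.Properties.CommutativeSemigroup +-commutativeSemigroup using (interchange)
open import Algebra.Properties.Semiring.Sum +-*-semiring
  using (sum; sum-cong-≗; sum-replicate-zero; ∑-distrib-+; ∑-comm; *-distribˡ-sum; *-distribʳ-sum)
open import Data.Bool using (if_then_else_)
open import Data.Empty using (⊥; ⊥-elim)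
open import Data.Fin using (Fin; toℕ) renaming (zero to 0F; suc to sucF)
open import Data.Fin.Properties using (toℕ<n)
open import Data.List using (List; []; _∷_; _++_; map; concatMap; applyUpTo; upTo; filter; length)
import Data.List.Relation.Unary.All as All
open import Data.List.Properties using (filter-≐; filter-none)
open import Data.Nat using (ℕ; zero; suc; _+_; _*_; _∸_; _^_; _/_; _≤_; _<_; _>_; _≤?_; _<?_; _≟_; z≤n; s≤s; s≤s⁻¹)
open import Data.Nat.DivMod using (m*n/n≡m; _%_; [m+kn]%n≡m%n)
open import Data.Nat.Divisibility using (_∣_; divides; n∣m⇒m%n≡0)
open import Data.Nat.Tactic.RingSolver using (solve-∀; solve)
open import Data.Product.Properties using (≡-dec)
import Function.Properties.Equivalence
open import Relation.Nullary.Decidable using (_×-dec_; _⊎-dec_)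
open import Relation.Unary using (Decidable)
open import Relation.Binary.Definitions using (Tri; tri<; tri≈; tri>)

-- Iverson brackets and finite sums

𝟙 : {P : Set} → Dec P → ℕ
𝟙 P? = if does P? then 1 else 0

private variable
  P Q : Set
  A B : Set

𝟙-yes : (P? : Dec P) → P → 𝟙 P? ≡ 1
𝟙-yes (yes _) _ = refl
𝟙-yes (no ¬p) p = ⊥-elim (¬p p)

𝟙-no : (P? : Dec P) → ¬ P → 𝟙 P? ≡ 0
𝟙-no (yes p) ¬p = ⊥-elim (¬p p)
𝟙-no (no _) _ = refl

𝟙-⇔ : (P? : Dec P) (Q? : Dec Q) → P ⇔ Q → 𝟙 P? ≡ 𝟙 Q?
𝟙-⇔ (yes p) Q? P⇔Q = sym (𝟙-yes Q? (Equivalence.to P⇔Q p))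
𝟙-⇔ (no ¬p) Q? P⇔Q = sym (𝟙-no Q? (¬p ∘ Equivalence.from P⇔Q))

𝟙-× : (P? : Dec P) (Q? : Dec Q) → 𝟙 (P? ×-dec Q?) ≡ 𝟙 P? * 𝟙 Q?
𝟙-× (yes _) (yes _) = refl
𝟙-× (yes _) (no _) = refl
𝟙-× (no _) _ = refl

𝟙-⊎ : (P? : Dec P) (Q? : Dec Q) → (P → Q → ⊥) → 𝟙 (P? ⊎-dec Q?) ≡ 𝟙 P? + 𝟙 Q?
𝟙-⊎ (yes p) (yes q) exclusive = ⊥-elim (exclusive p q)
𝟙-⊎ (yes _) (no _) _ = refl
𝟙-⊎ (no _) (yes _) _ = refl
𝟙-⊎ (no _) (no _) _ = refl

𝟙+𝟙≡2 : (P? : Dec P) (Q? : Dec Q) → 𝟙 (𝟙 P? + 𝟙 Q? ≟ 2) ≡ 𝟙 (P? ×-dec Q?)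
𝟙+𝟙≡2 (yes _) (yes _) = refl
𝟙+𝟙≡2 (yes _) (no _) = refl
𝟙+𝟙≡2 (no _) (yes _) = refl
𝟙+𝟙≡2 (no _) (no _) = refl

∑-list : {A : Set} → List A → (A → ℕ) → ℕ
∑-list [] f = 0
∑-list (x ∷ xs) f = f x + ∑-list xs f

syntax ∑-list xs (λ x → e) = ∑[ x ∈ xs ] e

∑< : ℕ → (ℕ → ℕ) → ℕ
∑< n f = sum {n} (f ∘ toℕ)

syntax ∑< n (λ i → e) = ∑[ i < n ] e


length-filter≡∑ : {P : A → Set} (P? : Decidable P) (xs : List A) → length (filter P? xs) ≡ ∑[ x ∈ xs ] 𝟙 (P? x)
length-filter≡∑ P? [] = refl
length-filter≡∑ P? (x ∷ xs) with P? x
... | yes _ = cong suc (length-filter≡∑ P? xs)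
... | no _ = length-filter≡∑ P? xs

∑-cong : (xs : List A) {f g : A → ℕ} → (∀ x → f x ≡ g x) → ∑-list xs f ≡ ∑-list xs g
∑-cong [] f≗g = refl
∑-cong (x ∷ xs) f≗g = cong₂ _+_ (f≗g x) (∑-cong xs f≗g)

∑-++ : (xs ys : List A) (f : A → ℕ) → ∑-list (xs ++ ys) f ≡ ∑-list xs f + ∑-list ys f
∑-++ [] ys f = refl
∑-++ (x ∷ xs) ys f = trans (cong (f x +_) (∑-++ xs ys f)) (sym (+-assoc (f x) _ _))

∑-+ : (xs : List A) (f g : A → ℕ) → ∑[ x ∈ xs ] (f x + g x) ≡ ∑-list xs f + ∑-list xs g
∑-+ [] f g = refl
∑-+ (x ∷ xs) f g = trans (cong (f x + g x +_) (∑-+ xs f g)) (interchange (f x) (g x) _ _)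

∑-map : (g : A → B) (xs : List A) (f : B → ℕ) → ∑-list (map g xs) f ≡ ∑-list xs (f ∘ g)
∑-map g [] f = refl
∑-map g (x ∷ xs) f = cong (f (g x) +_) (∑-map g xs f)

∑-concatMap : (g : A → List B) (xs : List A) (f : B → ℕ) →
              ∑-list (concatMap g xs) f ≡ ∑[ x ∈ xs ] ∑-list (g x) f
∑-concatMap g [] f = refl
∑-concatMap g (x ∷ xs) f = trans (∑-++ (g x) (concatMap g xs) f) (cong (∑-list (g x) f +_) (∑-concatMap g xs f))

∑-applyUpTo : (g : ℕ → ℕ) (n : ℕ) (f : ℕ → ℕ) → ∑-list (applyUpTo g n) f ≡ ∑< n (f ∘ g)
∑-applyUpTo g zero f = refl
∑-applyUpTo g (suc n) f = cong (f (g 0) +_) (∑-applyUpTo (g ∘ suc) n f)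

∑<-cong : (n : ℕ) {f g : ℕ → ℕ} → (∀ i → i < n → f i ≡ g i) → ∑< n f ≡ ∑< n g
∑<-cong n f≗g = sum-cong-≗ (λ i → f≗g (toℕ i) (toℕ<n i))

∑<-+ : (n : ℕ) (f g : ℕ → ℕ) → ∑[ i < n ] (f i + g i) ≡ ∑< n f + ∑< n g
∑<-+ n f g = ∑-distrib-+ {n} (f ∘ toℕ) (g ∘ toℕ)

∑<-*ˡ : (n c : ℕ) (f : ℕ → ℕ) → c * ∑< n f ≡ ∑[ i < n ] (c * f i)
∑<-*ˡ n c f = *-distribˡ-sum {n} c (f ∘ toℕ)

∑<-*ʳ : (n c : ℕ) (f : ℕ → ℕ) → ∑< n f * c ≡ ∑[ i < n ] (f i * c)
∑<-*ʳ n c f = *-distribʳ-sum {n} c (f ∘ toℕ)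

∑<-sum-comm : (n m : ℕ) (f : ℕ → Fin m → ℕ) → ∑[ i < n ] sum (f i) ≡ sum (λ k → ∑[ i < n ] f i k)
∑<-sum-comm n m f = ∑-comm {n} {m} (λ i k → f (toℕ i) k)

∑<-δ : (n k : ℕ) (h : ℕ → ℕ) → ∑[ i < n ] (𝟙 (i ≟ k) * h i) ≡ 𝟙 (k <? n) * h k
∑<-δ zero k h = refl
∑<-δ (suc n) zero h = trans (cong (1 * h 0 +_) (∑<-zero n)) (+-identityʳ (1 * h 0))
  where ∑<-zero : ∀ n → ∑[ i < n ] (𝟙 (suc i ≟ 0) * h (suc i)) ≡ 0
        ∑<-zero zero = refl
        ∑<-zero (suc n) = ∑<-zero n
∑<-δ (suc n) (suc k) h = ∑<-δ n k (h ∘ suc)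

infix 4 _≟_⊖_

_≟_⊖_ : ∀ x β α → Dec (x ≡ β ⊖ α)
x ≟ β ⊖ α = β ≟ x + α

≡⊖⇔ : ∀ {x β α} → x ≡ β ⊖ α ⇔ (α ≤ β × x ≡ β ∸ α)
≡⊖⇔ {x} {β} {α} = mk⇔ to from
  where
  to : x ≡ β ⊖ α → α ≤ β × x ≡ β ∸ α
  to refl = m≤n+m α x , sym (m+n∸n≡m x α)
  from : α ≤ β × x ≡ β ∸ α → x ≡ β ⊖ α
  from (α≤β , refl) = sym (m∸n+n≡m α≤β)

<∸⇔+< : ∀ {x y n} → y < n ∸ x ⇔ x + y < n
<∸⇔+< {x} {y} {n} = mk⇔ to from
  where
  to : y < n ∸ x → x + y < n
  to y<n∸x = subst (_≤ n) (cong suc (+-comm y x)) (m≤o∸n⇒m+n≤o (suc y) x≤n y<n∸x)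
    where x≤n = <⇒≤ (m∸n≢0⇒n<m (λ n∸x≡0 → contradiction (subst (y <_) n∸x≡0 y<n∸x) λ ()))
  from : x + y < n → y < n ∸ x
  from x+y<n = m+n≤o⇒m≤o∸n (suc y) (subst (_≤ n) (cong suc (+-comm x y)) x+y<n)

∑<-δ⊖ : (n α β : ℕ) (h : ℕ → ℕ) → ∑[ i < n ] (𝟙 (i ≟ β ⊖ α) * h i) ≡ 𝟙 (α ≤? β) * (𝟙 (β ∸ α <? n) * h (β ∸ α))
∑<-δ⊖ n α β h = begin
  ∑[ i < n ] (𝟙 (i ≟ β ⊖ α) * h i)                 ≡⟨ ∑<-cong n (λ i _ → split i) ⟩
  ∑[ i < n ] (𝟙 (α ≤? β) * (𝟙 (i ≟ β ∸ α) * h i))  ≡⟨ ∑<-*ˡ n (𝟙 (α ≤? β)) (λ i → 𝟙 (i ≟ β ∸ α) * h i) ⟨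
  𝟙 (α ≤? β) * ∑[ i < n ] (𝟙 (i ≟ β ∸ α) * h i)   ≡⟨ cong (𝟙 (α ≤? β) *_) (∑<-δ n (β ∸ α) h) ⟩
  𝟙 (α ≤? β) * (𝟙 (β ∸ α <? n) * h (β ∸ α))       ∎
  where
  split : ∀ i → 𝟙 (i ≟ β ⊖ α) * h i ≡ 𝟙 (α ≤? β) * (𝟙 (i ≟ β ∸ α) * h i)
  split i = trans (cong (_* h i) (trans (𝟙-⇔ (i ≟ β ⊖ α) (α ≤? β ×-dec i ≟ β ∸ α) ≡⊖⇔) (𝟙-× (α ≤? β) (i ≟ β ∸ α))))
                  (*-assoc (𝟙 (α ≤? β)) _ (h i))

∑T : ℕ → (Point → ℕ) → ℕ
∑T n f = ∑[ a < n ] ∑[ b < n ∸ a ] f (a , b)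

_∈T_ : Point → ℕ → Set
(a , b) ∈T n = a + b < n

∑-T : (n : ℕ) (f : Point → ℕ) → ∑-list (T n) f ≡ ∑T n f
∑-T n f = begin
  ∑-list (T n) f                                                ≡⟨ ∑-concatMap _ (upTo n) f ⟩
  ∑[ a ∈ upTo n ] ∑-list (map (a ,_) (upTo (n ∸ a))) f          ≡⟨ ∑-cong (upTo n) (λ a → ∑-map (a ,_) (upTo (n ∸ a)) f) ⟩
  ∑[ a ∈ upTo n ] ∑[ b ∈ upTo (n ∸ a) ] f (a , b)               ≡⟨ ∑-cong (upTo n) (λ a → ∑-applyUpTo (λ b → b) (n ∸ a) _) ⟩
  ∑[ a ∈ upTo n ] ∑[ b < n ∸ a ] f (a , b)                      ≡⟨ ∑-applyUpTo (λ a → a) n _ ⟩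
  ∑T n f                                                        ∎

∑T-cong : (n : ℕ) {f g : Point → ℕ} → (∀ a b → (a , b) ∈T n → f (a , b) ≡ g (a , b)) → ∑T n f ≡ ∑T n g
∑T-cong n f≗g = ∑<-cong n (λ a _ → ∑<-cong (n ∸ a) (λ b b<n∸a → f≗g a b (Equivalence.to <∸⇔+< b<n∸a)))

∑T-+ : (n : ℕ) (f g : Point → ℕ) → ∑T n (λ p → f p + g p) ≡ ∑T n f + ∑T n g
∑T-+ n f g = trans (∑<-cong n (λ a _ → ∑<-+ (n ∸ a) (λ b → f (a , b)) (λ b → g (a , b))))
                   (∑<-+ n (λ a → ∑[ b < n ∸ a ] f (a , b)) (λ a → ∑[ b < n ∸ a ] g (a , b)))

∑T-sum-comm : (n m : ℕ) (f : Point → Fin m → ℕ) → ∑T n (λ p → sum (f p)) ≡ sum (λ k → ∑T n (λ p → f p k))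
∑T-sum-comm n m f = trans (∑<-cong n (λ a _ → ∑<-sum-comm (n ∸ a) m (λ b → f (a , b))))
                          (∑<-sum-comm n m (λ a k → ∑[ b < n ∸ a ] f (a , b) k))

∑T²-sum-comm : (n m : ℕ) (f : Point → Point → Fin m → ℕ) →
               ∑T n (λ p → ∑T n (λ q → sum (f p q))) ≡ sum (λ k → ∑T n (λ p → ∑T n (λ q → f p q k)))
∑T²-sum-comm n m f = trans (∑T-cong n (λ a b _ → ∑T-sum-comm n m (f (a , b))))
                           (∑T-sum-comm n m (λ p k → ∑T n (λ q → f p q k)))

∑T-comm : (n m : ℕ) (f : Point → Point → ℕ) → ∑T n (λ p → ∑T m (f p)) ≡ ∑T m (λ q → ∑T n (λ p → f p q))
∑T-comm n m f = trans (∑T-sum-comm n m (λ p c → ∑[ d < m ∸ toℕ c ] f p (toℕ c , d)))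
                      (∑<-cong m (λ c _ → ∑T-sum-comm n (m ∸ c) (λ p d → f p (c , toℕ d))))

∑T-δ : (n α β γ δ : ℕ) (h : Point → ℕ) →
       ∑T n (λ { (c , d) → 𝟙 (c ≟ β ⊖ α ×-dec d ≟ δ ⊖ γ) * h (c , d) })
       ≡ 𝟙 (α ≤? β ×-dec γ ≤? δ ×-dec β ∸ α + (δ ∸ γ) <? n) * h (β ∸ α , δ ∸ γ)
∑T-δ n α β γ δ h = begin
  ∑[ c < n ] ∑[ d < n ∸ c ] (𝟙 (c ≟ β ⊖ α ×-dec d ≟ δ ⊖ γ) * h (c , d))
    ≡⟨ ∑<-cong n (λ c _ → trans (∑<-cong (n ∸ c) (λ d _ → split c d))
                                (sym (∑<-*ˡ (n ∸ c) (𝟙 (c ≟ β ⊖ α)) (λ d → 𝟙 (d ≟ δ ⊖ γ) * h (c , d))))) ⟩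
  ∑[ c < n ] (𝟙 (c ≟ β ⊖ α) * ∑[ d < n ∸ c ] (𝟙 (d ≟ δ ⊖ γ) * h (c , d)))
    ≡⟨ ∑<-cong n (λ c _ → cong (𝟙 (c ≟ β ⊖ α) *_) (∑<-δ⊖ (n ∸ c) γ δ (λ d → h (c , d)))) ⟩
  ∑[ c < n ] (𝟙 (c ≟ β ⊖ α) * (𝟙 (γ ≤? δ) * (𝟙 (y <? n ∸ c) * h (c , y))))
    ≡⟨ ∑<-δ⊖ n α β (λ c → 𝟙 (γ ≤? δ) * (𝟙 (y <? n ∸ c) * h (c , y))) ⟩
  𝟙 (α ≤? β) * (𝟙 (x <? n) * (𝟙 (γ ≤? δ) * (𝟙 (y <? n ∸ x) * H)))
    ≡⟨ reorder (𝟙 (α ≤? β)) (𝟙 (x <? n)) (𝟙 (γ ≤? δ)) (𝟙 (y <? n ∸ x)) H ⟩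
  𝟙 (α ≤? β) * (𝟙 (γ ≤? δ) * (𝟙 (x <? n) * 𝟙 (y <? n ∸ x))) * H
    ≡⟨ cong (λ e → 𝟙 (α ≤? β) * (𝟙 (γ ≤? δ) * e) * H) in-T ⟩
  𝟙 (α ≤? β) * (𝟙 (γ ≤? δ) * 𝟙 (x + y <? n)) * H
    ≡⟨ cong (_* H) (trans (𝟙-× (α ≤? β) (γ ≤? δ ×-dec x + y <? n)) (cong (𝟙 (α ≤? β) *_) (𝟙-× (γ ≤? δ) (x + y <? n)))) ⟨
  𝟙 (α ≤? β ×-dec γ ≤? δ ×-dec x + y <? n) * H
    ∎
  where
  x = β ∸ α
  y = δ ∸ γ
  H = h (x , y)
  split : ∀ c d → 𝟙 (c ≟ β ⊖ α ×-dec d ≟ δ ⊖ γ) * h (c , d) ≡ 𝟙 (c ≟ β ⊖ α) * (𝟙 (d ≟ δ ⊖ γ) * h (c , d))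
  split c d = trans (cong (_* h (c , d)) (𝟙-× (c ≟ β ⊖ α) (d ≟ δ ⊖ γ))) (*-assoc (𝟙 (c ≟ β ⊖ α)) (𝟙 (d ≟ δ ⊖ γ)) (h (c , d)))
  reorder : ∀ a b c d e → a * (b * (c * (d * e))) ≡ a * (c * (b * d)) * e
  reorder = solve-∀
  in-T : 𝟙 (x <? n) * 𝟙 (y <? n ∸ x) ≡ 𝟙 (x + y <? n)
  in-T = trans (sym (𝟙-× (x <? n) (y <? n ∸ x)))
               (𝟙-⇔ (x <? n ×-dec y <? n ∸ x) (x + y <? n)
                    (mk⇔ (Equivalence.to <∸⇔+< ∘ proj₂)
                         (λ x+y<n → ≤-<-trans (m≤m+n x y) x+y<n , Equivalence.from <∸⇔+< x+y<n)))

tri : ℕ → ℕ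
tri zero = 0
tri (suc m) = suc m + tri m

∑<-shift : (B m : ℕ) (g : ℕ → ℕ) → ∑[ b < m ] (𝟙 (B ≤? b) * g b) ≡ ∑[ b < m ∸ B ] g (B + b)
∑<-shift zero m g = ∑<-cong m (λ b _ → *-identityˡ (g b))
∑<-shift (suc B) zero g = refl
∑<-shift (suc B) (suc m) g =
  trans (∑<-cong m (λ b _ → cong (_* g (suc b)) (𝟙-⇔ (suc B ≤? suc b) (B ≤? b) (mk⇔ s≤s⁻¹ s≤s))))
        (∑<-shift B m (g ∘ suc))

∑<-count : (m L : ℕ) → L ≤ m → ∑[ b < m ] 𝟙 (b <? L) ≡ L
∑<-count m zero _ = sum-replicate-zero m
∑<-count (suc m) (suc L) (s≤s L≤m) = cong suc (∑<-count m L L≤m)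

∑<-tri : (m M : ℕ) → M ≤ m → ∑[ a < m ] (M ∸ a) ≡ tri M
∑<-tri m zero _ = trans (∑<-cong m (λ a _ → 0∸n≡0 a)) (sum-replicate-zero m)
∑<-tri (suc m) (suc M) (s≤s M≤m) = cong (suc M +_) (∑<-tri m M M≤m)

∑T-subtriangle : (n A B Γ : ℕ) →
  ∑T n (λ { (a , b) → 𝟙 (A ≤? a ×-dec B ≤? b ×-dec a + b + Γ <? n) }) ≡ tri (n ∸ (A + B + Γ))
∑T-subtriangle n A B Γ = begin
  ∑[ a < n ] ∑[ b < n ∸ a ] 𝟙 (A ≤? a ×-dec B ≤? b ×-dec a + b + Γ <? n)
    ≡⟨ ∑<-cong n (λ a _ → trans (∑<-cong (n ∸ a) (λ b _ → split a b))
                                (sym (∑<-*ˡ (n ∸ a) (𝟙 (A ≤? a)) (λ b → 𝟙 (B ≤? b) * 𝟙 (a + b + Γ <? n))))) ⟩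
  ∑[ a < n ] (𝟙 (A ≤? a) * ∑[ b < n ∸ a ] (𝟙 (B ≤? b) * 𝟙 (a + b + Γ <? n)))
    ≡⟨ ∑<-cong n (λ a _ → cong (𝟙 (A ≤? a) *_) (row a)) ⟩
  ∑[ a < n ] (𝟙 (A ≤? a) * (n ∸ (a + B + Γ)))
    ≡⟨ ∑<-shift A n (λ a → n ∸ (a + B + Γ)) ⟩
  ∑[ a < n ∸ A ] (n ∸ (A + a + B + Γ))
    ≡⟨ ∑<-cong (n ∸ A) (λ a _ → trans (cong (n ∸_) (shuffle A a B Γ)) (sym (∸-+-assoc n (A + B + Γ) a))) ⟩
  ∑[ a < n ∸ A ] (n ∸ (A + B + Γ) ∸ a)
    ≡⟨ ∑<-tri (n ∸ A) (n ∸ (A + B + Γ)) (∸-monoʳ-≤ n (≤-trans (m≤m+n A B) (m≤m+n (A + B) Γ))) ⟩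
  tri (n ∸ (A + B + Γ))
    ∎
  where
  split : ∀ a b → 𝟙 (A ≤? a ×-dec B ≤? b ×-dec a + b + Γ <? n) ≡ 𝟙 (A ≤? a) * (𝟙 (B ≤? b) * 𝟙 (a + b + Γ <? n))
  split a b = trans (𝟙-× (A ≤? a) (B ≤? b ×-dec a + b + Γ <? n)) (cong (𝟙 (A ≤? a) *_) (𝟙-× (B ≤? b) (a + b + Γ <? n)))
  shuffle : ∀ A a B Γ → A + a + B + Γ ≡ A + B + Γ + a
  shuffle = solve-∀
  row : ∀ a → ∑[ b < n ∸ a ] (𝟙 (B ≤? b) * 𝟙 (a + b + Γ <? n)) ≡ n ∸ (a + B + Γ)
  row a = begin
    ∑[ b < n ∸ a ] (𝟙 (B ≤? b) * 𝟙 (a + b + Γ <? n))     ≡⟨ ∑<-shift B (n ∸ a) (λ b → 𝟙 (a + b + Γ <? n)) ⟩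
    ∑[ b < n ∸ a ∸ B ] 𝟙 (a + (B + b) + Γ <? n)
      ≡⟨ ∑<-cong (n ∸ a ∸ B) (λ b _ → 𝟙-⇔ (a + (B + b) + Γ <? n) (b <? n ∸ (a + B + Γ)) (bound b)) ⟩
    ∑[ b < n ∸ a ∸ B ] 𝟙 (b <? n ∸ (a + B + Γ))          ≡⟨ ∑<-count (n ∸ a ∸ B) (n ∸ (a + B + Γ)) fits ⟩
    n ∸ (a + B + Γ)                                      ∎
    where
    bound : ∀ b → a + (B + b) + Γ < n ⇔ b < n ∸ (a + B + Γ)
    bound b = Function.Properties.Equivalence.sym (subst (λ s → b < n ∸ (a + B + Γ) ⇔ s < n) (shuffle′ a B b Γ) <∸⇔+<)
      where shuffle′ : ∀ a B b Γ → a + B + Γ + b ≡ a + (B + b) + Γ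
            shuffle′ = solve-∀
    fits : n ∸ (a + B + Γ) ≤ n ∸ a ∸ B
    fits = subst (n ∸ (a + B + Γ) ≤_) (sym (∸-+-assoc n a B)) (∸-monoʳ-≤ n (m≤m+n (a + B) Γ))

∑²-δ : (n : ℕ) {X : Set} (X? : Dec X) {P : ℕ → ℕ → Set} (P? : ∀ i j → Dec (P i j)) (i₀ j₀ : ℕ) →
       (∀ i j → P i j ⇔ (i ≡ i₀ × j ≡ j₀ × X)) → (X → i₀ < n × j₀ < n) →
       ∑[ i < n ] ∑[ j < n ] 𝟙 (P? i j) ≡ 𝟙 X?
∑²-δ n X? P? i₀ j₀ P⇔ in-range = begin
  ∑[ i < n ] ∑[ j < n ] 𝟙 (P? i j)
    ≡⟨ ∑<-cong n (λ i _ → ∑<-cong n (λ j _ → split i j)) ⟩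
  ∑[ i < n ] ∑[ j < n ] (𝟙 (i ≟ i₀) * (𝟙 (j ≟ j₀) * 𝟙 X?))
    ≡⟨ ∑<-cong n (λ i _ → trans (sym (∑<-*ˡ n (𝟙 (i ≟ i₀)) (λ j → 𝟙 (j ≟ j₀) * 𝟙 X?)))
                                (cong (𝟙 (i ≟ i₀) *_) (∑<-δ n j₀ (λ _ → 𝟙 X?)))) ⟩
  ∑[ i < n ] (𝟙 (i ≟ i₀) * (𝟙 (j₀ <? n) * 𝟙 X?))
    ≡⟨ ∑<-δ n i₀ (λ _ → 𝟙 (j₀ <? n) * 𝟙 X?) ⟩
  𝟙 (i₀ <? n) * (𝟙 (j₀ <? n) * 𝟙 X?)
    ≡⟨ drop-bounds X? ⟩
  𝟙 X?
    ∎
  where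
  split : ∀ i j → 𝟙 (P? i j) ≡ 𝟙 (i ≟ i₀) * (𝟙 (j ≟ j₀) * 𝟙 X?)
  split i j = trans (𝟙-⇔ (P? i j) (i ≟ i₀ ×-dec j ≟ j₀ ×-dec X?) (P⇔ i j))
                    (trans (𝟙-× (i ≟ i₀) (j ≟ j₀ ×-dec X?)) (cong (𝟙 (i ≟ i₀) *_) (𝟙-× (j ≟ j₀) X?)))
  drop-bounds : (X? : Dec _) → 𝟙 (i₀ <? n) * (𝟙 (j₀ <? n) * 𝟙 X?) ≡ 𝟙 X?
  drop-bounds (yes x) rewrite 𝟙-yes (i₀ <? n) (proj₁ (in-range x)) | 𝟙-yes (j₀ <? n) (proj₂ (in-range x)) = refl
  drop-bounds (no _) = trans (cong (𝟙 (i₀ <? n) *_) (*-zeroʳ (𝟙 (j₀ <? n)))) (*-zeroʳ (𝟙 (i₀ <? n)))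

-- Counting third vertices

pattern 1F = sucF 0F
pattern 2F = sucF (sucF 0F)

apex? : ∀ p q r → Dec (Apex p q r)
apex? (a , b) (c , d) (e , f) = e ≟ a + b ⊖ d ×-dec f ≟ c + d ⊖ a

-- The apex of (p , q) lies in T n: its coordinates a + b - d and c + d - a are
-- natural and sum to b + c.
ApexIn : ℕ → Point → Point → Set
ApexIn n (a , b) (c , d) = d ≤ a + b × a ≤ c + d × b + c < n

apexIn? : ∀ n p q → Dec (ApexIn n p q)
apexIn? n (a , b) (c , d) = d ≤? a + b ×-dec a ≤? c + d ×-dec b + c <? n

∑-apex : ∀ n p q → ∑T n (𝟙 ∘ apex? p q) ≡ 𝟙 (apexIn? n p q)
∑-apex n (a , b) (c , d) = begin
  ∑T n (𝟙 ∘ apex? (a , b) (c , d))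
    ≡⟨ ∑T-cong n (λ e f _ → sym (*-identityʳ (𝟙 (apex? (a , b) (c , d) (e , f))))) ⟩
  ∑T n (λ r → 𝟙 (apex? (a , b) (c , d) r) * 1)
    ≡⟨ ∑T-δ n d (a + b) a (c + d) (λ _ → 1) ⟩
  𝟙 (d ≤? a + b ×-dec a ≤? c + d ×-dec x + y <? n) * 1
    ≡⟨ *-identityʳ _ ⟩
  𝟙 (d ≤? a + b ×-dec a ≤? c + d ×-dec x + y <? n)
    ≡⟨ 𝟙-⇔ (d ≤? a + b ×-dec a ≤? c + d ×-dec x + y <? n) (apexIn? n (a , b) (c , d)) (mk⇔ to from) ⟩
  𝟙 (apexIn? n (a , b) (c , d))
    ∎
  where
  x = a + b ∸ d
  y = c + d ∸ a
  x+y≡b+c : d ≤ a + b → a ≤ c + d → x + y ≡ b + c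
  x+y≡b+c d≤a+b a≤c+d = +-cancelʳ-≡ (d + a) _ _ (begin
    x + y + (d + a)             ≡⟨ shuffle x y d a ⟩
    (x + d) + (y + a)           ≡⟨ cong₂ _+_ (m∸n+n≡m d≤a+b) (m∸n+n≡m a≤c+d) ⟩
    (a + b) + (c + d)           ≡⟨ shuffle′ a b c d ⟩
    b + c + (d + a)             ∎)
    where shuffle : ∀ x y d a → x + y + (d + a) ≡ (x + d) + (y + a)
          shuffle = solve-∀
          shuffle′ : ∀ a b c d → (a + b) + (c + d) ≡ b + c + (d + a)
          shuffle′ = solve-∀
  to : d ≤ a + b × a ≤ c + d × x + y < n → ApexIn n (a , b) (c , d)
  to (d≤a+b , a≤c+d , x+y<n) = d≤a+b , a≤c+d , subst (_< n) (x+y≡b+c d≤a+b a≤c+d) x+y<n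
  from : ApexIn n (a , b) (c , d) → d ≤ a + b × a ≤ c + d × x + y < n
  from (d≤a+b , a≤c+d , b+c<n) = d≤a+b , a≤c+d , subst (_< n) (sym (x+y≡b+c d≤a+b a≤c+d)) b+c<n

thirdVertices≡ : ∀ n {p q} → p ≢ q → thirdVertices n (p , q) ≡ 𝟙 (apexIn? n p q) + 𝟙 (apexIn? n q p)
thirdVertices≡ n {p} {q} p≢q = begin
  length (filter (equilateral? p q) (T n))              ≡⟨ length-filter≡∑ (equilateral? p q) (T n) ⟩
  ∑-list (T n) (𝟙 ∘ equilateral? p q)                   ≡⟨ ∑-T n _ ⟩
  ∑T n (𝟙 ∘ equilateral? p q)                           ≡⟨ ∑T-cong n (λ e f _ → one-of-two (e , f)) ⟩
  ∑T n (λ r → 𝟙 (apex? p q r) + 𝟙 (apex? q p r))        ≡⟨ ∑T-+ n (𝟙 ∘ apex? p q) (𝟙 ∘ apex? q p) ⟩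
  ∑T n (𝟙 ∘ apex? p q) + ∑T n (𝟙 ∘ apex? q p)           ≡⟨ cong₂ _+_ (∑-apex n p q) (∑-apex n q p) ⟩
  𝟙 (apexIn? n p q) + 𝟙 (apexIn? n q p)                 ∎
  where
  one-of-two : ∀ r → 𝟙 (equilateral? p q r) ≡ 𝟙 (apex? p q r) + 𝟙 (apex? q p r)
  one-of-two r = trans (𝟙-⇔ (equilateral? p q r) (apex? p q r ⊎-dec apex? q p r) (equilateral⇔apex p≢q))
                       (𝟙-⊎ (apex? p q r) (apex? q p r) (λ x y → p≢q (apex-exclusive x y)))

thirdVertices-comm : ∀ n p q → thirdVertices n (p , q) ≡ thirdVertices n (q , p)
thirdVertices-comm n p q = cong length (filter-≐ (equilateral? p q) (equilateral? q p) swap⇔ (T n))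
  where swap⇔ = (λ {r} → equilateral-swap {p} {q} {r}) , (λ {r} → equilateral-swap {q} {p} {r})

thirdVertices-diagonal : ∀ n p → thirdVertices n (p , p) ≡ 0
thirdVertices-diagonal n p =
  cong length (filter-none (equilateral? p p) (All.universal (λ r → ¬equilateral-diagonal {p} {r}) (T n)))

∑-pairs : {A : Set} (F : A × A → ℕ) → (∀ x y → F (x , y) ≡ F (y , x)) → (∀ x → F (x , x) ≡ 0) →
          (xs : List A) → 2 * ∑-list (pairs xs) F ≡ ∑[ x ∈ xs ] ∑[ y ∈ xs ] F (x , y)
∑-pairs F F-comm F-diag [] = refl
∑-pairs F F-comm F-diag (x ∷ xs) = begin
  2 * ∑-list (map (x ,_) xs ++ pairs xs) F
    ≡⟨ cong (2 *_) (trans (∑-++ (map (x ,_) xs) (pairs xs) F) (cong (_+ ∑-list (pairs xs) F) (∑-map (x ,_) xs F))) ⟩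
  2 * (S + ∑-list (pairs xs) F)
    ≡⟨ *-distribˡ-+ 2 S (∑-list (pairs xs) F) ⟩
  2 * S + 2 * ∑-list (pairs xs) F
    ≡⟨ cong (2 * S +_) (∑-pairs F F-comm F-diag xs) ⟩
  2 * S + R
    ≡⟨ double S R ⟩
  S + (S + R)
    ≡⟨ cong (λ t → S + (t + R)) (∑-cong xs (F-comm x)) ⟩
  S + (∑[ y ∈ xs ] F (y , x) + R)
    ≡⟨ cong (S +_) (∑-+ xs (λ y → F (y , x)) (λ y → ∑[ z ∈ xs ] F (y , z))) ⟨
  S + ∑[ y ∈ xs ] (F (y , x) + ∑[ z ∈ xs ] F (y , z))
    ≡⟨ cong (λ t → t + S + ∑[ y ∈ xs ] (F (y , x) + ∑[ z ∈ xs ] F (y , z))) (F-diag x) ⟨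
  F (x , x) + S + ∑[ y ∈ xs ] (F (y , x) + ∑[ z ∈ xs ] F (y , z))
    ∎
  where
  S = ∑[ y ∈ xs ] F (x , y)
  R = ∑[ y ∈ xs ] ∑[ z ∈ xs ] F (y , z)
  double : ∀ s r → 2 * s + r ≡ s + (s + r)
  double = solve-∀

Rhombus : ℕ → Point → Point → Set
Rhombus n p q = ApexIn n p q × ApexIn n q p

rhombus? : ∀ n p q → Dec (Rhombus n p q)
rhombus? n p q = apexIn? n p q ×-dec apexIn? n q p

rhombus-comm : ∀ n p q → 𝟙 (rhombus? n p q) ≡ 𝟙 (rhombus? n q p)
rhombus-comm n p q = 𝟙-⇔ (rhombus? n p q) (rhombus? n q p) (mk⇔ swap swap)
  where open Data.Product using (swap)

twoThirdVertices : ℕ → Point → Point → ℕ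
twoThirdVertices n p q = 𝟙 (thirdVertices n (p , q) ≟ 2)

twoThirdVertices≡rhombus : ∀ n {p q} → p ≢ q → twoThirdVertices n p q ≡ 𝟙 (rhombus? n p q)
twoThirdVertices≡rhombus n {p} {q} p≢q =
  trans (cong (λ t → 𝟙 (t ≟ 2)) (thirdVertices≡ n p≢q)) (𝟙+𝟙≡2 (apexIn? n p q) (apexIn? n q p))

2a₂≡∑∑ : ∀ n → 2 * a 2 n ≡ ∑T n (λ p → ∑T n (twoThirdVertices n p))
2a₂≡∑∑ n = begin
  2 * a 2 n
    ≡⟨ cong (2 *_) (length-filter≡∑ (λ pr → thirdVertices n pr ≟ 2) (pairs (T n))) ⟩
  2 * ∑-list (pairs (T n)) (λ pr → 𝟙 (thirdVertices n pr ≟ 2))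
    ≡⟨ ∑-pairs (λ pr → 𝟙 (thirdVertices n pr ≟ 2))
               (λ p q → cong (λ t → 𝟙 (t ≟ 2)) (thirdVertices-comm n p q))
               (λ p → cong (λ t → 𝟙 (t ≟ 2)) (thirdVertices-diagonal n p)) (T n) ⟩
  ∑[ p ∈ T n ] ∑-list (T n) (twoThirdVertices n p)
    ≡⟨ ∑-cong (T n) (λ p → ∑-T n (twoThirdVertices n p)) ⟩
  ∑[ p ∈ T n ] ∑T n (twoThirdVertices n p)
    ≡⟨ ∑-T n (λ p → ∑T n (twoThirdVertices n p)) ⟩
  ∑T n (λ p → ∑T n (twoThirdVertices n p))
    ∎

-- Sectors of directions

-- The k-th of the three sectors ρᵏ {(x , y) | x > 0 , y ≥ 0} that together
-- form a half-plane of directions; InSector k p q says q - p lies in it.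
InSector : Fin 3 → Point → Point → Set
InSector 0F (a , b) (c , d) = a < c × b ≤ d
InSector 1F (a , b) (c , d) = c ≤ a × a + b < c + d
InSector 2F (a , b) (c , d) = b < d × c + d ≤ a + b

inSector? : ∀ k p q → Dec (InSector k p q)
inSector? 0F (a , b) (c , d) = a <? c ×-dec b ≤? d
inSector? 1F (a , b) (c , d) = c ≤? a ×-dec a + b <? c + d
inSector? 2F (a , b) (c , d) = b <? d ×-dec c + d ≤? a + b

halfPlane : Point → Point → ℕ
halfPlane p q = sum (λ k → 𝟙 (inSector? k p q))

halfPlane-diagonal : ∀ p → halfPlane p p ≡ 0
halfPlane-diagonal (a , b) = cong₂ _+_ (𝟙-no (inSector? 0F (a , b) (a , b)) (<-irrefl refl ∘ proj₁))
                            (cong₂ _+_ (𝟙-no (inSector? 1F (a , b) (a , b)) (<-irrefl refl ∘ proj₂))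
                                       (cong (_+ 0) (𝟙-no (inSector? 2F (a , b) (a , b)) (<-irrefl refl ∘ proj₁))))

private
  [<] [≡] [>] : ∀ {x y} → Tri (x < y) (x ≡ y) (x > y) → ℕ
  [<] (tri< _ _ _) = 1
  [<] _ = 0
  [≡] (tri≈ _ _ _) = 1
  [≡] _ = 0
  [>] (tri> _ _ _) = 1
  [>] _ = 0

  𝟙< : ∀ x y → 𝟙 (x <? y) ≡ [<] (<-cmp x y)
  𝟙< x y with <-cmp x y
  ... | tri< x<y _ _ = 𝟙-yes (x <? y) x<y
  ... | tri≈ _ x≡y _ = 𝟙-no (x <? y) (<-irrefl x≡y)
  ... | tri> _ _ x>y = 𝟙-no (x <? y) (<-asym x>y)

  𝟙> : ∀ x y → 𝟙 (y <? x) ≡ [>] (<-cmp x y)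
  𝟙> x y with <-cmp x y
  ... | tri< x<y _ _ = 𝟙-no (y <? x) (<-asym x<y)
  ... | tri≈ _ x≡y _ = 𝟙-no (y <? x) (<-irrefl (sym x≡y))
  ... | tri> _ _ x>y = 𝟙-yes (y <? x) x>y

  𝟙≤ : ∀ x y → 𝟙 (x ≤? y) ≡ [<] (<-cmp x y) + [≡] (<-cmp x y)
  𝟙≤ x y with <-cmp x y
  ... | tri< x<y _ _ = 𝟙-yes (x ≤? y) (<⇒≤ x<y)
  ... | tri≈ _ x≡y _ = 𝟙-yes (x ≤? y) (≤-reflexive x≡y)
  ... | tri> _ _ x>y = 𝟙-no (x ≤? y) (<⇒≱ x>y)

  𝟙≥ : ∀ x y → 𝟙 (y ≤? x) ≡ [≡] (<-cmp x y) + [>] (<-cmp x y)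
  𝟙≥ x y with <-cmp x y
  ... | tri< x<y _ _ = 𝟙-no (y ≤? x) (<⇒≱ x<y)
  ... | tri≈ _ x≡y _ = 𝟙-yes (y ≤? x) (≤-reflexive (sym x≡y))
  ... | tri> _ _ x>y = 𝟙-yes (y ≤? x) (<⇒≤ x>y)

  sectors : ∀ {a b c d} → Tri (a < c) (a ≡ c) (a > c) → Tri (b < d) (b ≡ d) (b > d) →
            Tri (a + b < c + d) (a + b ≡ c + d) (a + b > c + d) → ℕ
  sectors t₁ t₂ t₃ =
      ([<] t₁ * ([<] t₂ + [≡] t₂) + (([≡] t₁ + [>] t₁) * [<] t₃ + ([<] t₂ * ([≡] t₃ + [>] t₃) + 0)))
    + ([>] t₁ * ([≡] t₂ + [>] t₂) + (([<] t₁ + [≡] t₁) * [>] t₃ + ([>] t₂ * ([<] t₃ + [≡] t₃) + 0)))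

  halfPlane-sectors : ∀ a b c d →
    halfPlane (a , b) (c , d) + halfPlane (c , d) (a , b) ≡ sectors (<-cmp a c) (<-cmp b d) (<-cmp (a + b) (c + d))
  halfPlane-sectors a b c d
    rewrite 𝟙-× (a <? c) (b ≤? d) | 𝟙-× (c ≤? a) (a + b <? c + d) | 𝟙-× (b <? d) (c + d ≤? a + b)
          | 𝟙-× (c <? a) (d ≤? b) | 𝟙-× (a ≤? c) (c + d <? a + b) | 𝟙-× (d <? b) (a + b ≤? c + d)
          | 𝟙< a c | 𝟙≤ b d | 𝟙≥ a c | 𝟙< (a + b) (c + d) | 𝟙< b d | 𝟙≥ (a + b) (c + d)
          | 𝟙> a c | 𝟙≥ b d | 𝟙≤ a c | 𝟙> (a + b) (c + d) | 𝟙> b d | 𝟙≤ (a + b) (c + d) = refl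

halfPlane-antisym : ∀ {p q} → p ≢ q → halfPlane p q + halfPlane q p ≡ 1
halfPlane-antisym {a , b} {c , d} p≢q =
  trans (halfPlane-sectors a b c d) (exactly-one (<-cmp a c) (<-cmp b d) (<-cmp (a + b) (c + d)))
  where
  exactly-one : ∀ t₁ t₂ t₃ → sectors t₁ t₂ t₃ ≡ 1
  exactly-one (tri≈ _ a≡c _) (tri≈ _ b≡d _) _ = contradiction (cong₂ _,_ a≡c b≡d) p≢q
  exactly-one (tri< a<c _ _) (tri< b<d _ _) (tri≈ _ s≡t _) = contradiction s≡t (<⇒≢ (+-mono-< a<c b<d))
  exactly-one (tri< a<c _ _) (tri< b<d _ _) (tri> _ _ s>t) = contradiction s>t (<-asym (+-mono-< a<c b<d))
  exactly-one (tri< a<c _ _) (tri≈ _ b≡d _) (tri> _ _ s>t) = contradiction s>t (<-asym (+-mono-<-≤ a<c (≤-reflexive b≡d)))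
  exactly-one (tri≈ _ a≡c _) (tri< b<d _ _) (tri> _ _ s>t) = contradiction s>t (<-asym (+-mono-≤-< (≤-reflexive a≡c) b<d))
  exactly-one (tri> _ _ a>c) (tri> _ _ b>d) (tri≈ _ s≡t _) = contradiction (sym s≡t) (<⇒≢ (+-mono-< a>c b>d))
  exactly-one (tri> _ _ a>c) (tri> _ _ b>d) (tri< s<t _ _) = contradiction s<t (<-asym (+-mono-< a>c b>d))
  exactly-one (tri> _ _ a>c) (tri≈ _ b≡d _) (tri< s<t _ _) = contradiction s<t (<-asym (+-mono-<-≤ a>c (≤-reflexive (sym b≡d))))
  exactly-one (tri≈ _ a≡c _) (tri> _ _ b>d) (tri< s<t _ _) = contradiction s<t (<-asym (+-mono-≤-< (≤-reflexive (sym a≡c)) b>d))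
  exactly-one (tri< _ _ _) (tri< _ _ _) (tri< _ _ _) = refl
  exactly-one (tri< _ _ _) (tri≈ _ _ _) (tri< _ _ _) = refl
  exactly-one (tri< _ _ _) (tri≈ _ _ _) (tri≈ _ _ _) = refl
  exactly-one (tri< _ _ _) (tri> _ _ _) (tri< _ _ _) = refl
  exactly-one (tri< _ _ _) (tri> _ _ _) (tri≈ _ _ _) = refl
  exactly-one (tri< _ _ _) (tri> _ _ _) (tri> _ _ _) = refl
  exactly-one (tri≈ _ _ _) (tri< _ _ _) (tri< _ _ _) = refl
  exactly-one (tri≈ _ _ _) (tri< _ _ _) (tri≈ _ _ _) = refl
  exactly-one (tri≈ _ _ _) (tri> _ _ _) (tri≈ _ _ _) = refl
  exactly-one (tri≈ _ _ _) (tri> _ _ _) (tri> _ _ _) = refl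
  exactly-one (tri> _ _ _) (tri< _ _ _) (tri< _ _ _) = refl
  exactly-one (tri> _ _ _) (tri< _ _ _) (tri≈ _ _ _) = refl
  exactly-one (tri> _ _ _) (tri< _ _ _) (tri> _ _ _) = refl
  exactly-one (tri> _ _ _) (tri≈ _ _ _) (tri≈ _ _ _) = refl
  exactly-one (tri> _ _ _) (tri≈ _ _ _) (tri> _ _ _) = refl
  exactly-one (tri> _ _ _) (tri> _ _ _) (tri> _ _ _) = refl

twoThirdVertices≡ : ∀ n p q → twoThirdVertices n p q ≡ (halfPlane p q + halfPlane q p) * 𝟙 (rhombus? n p q)
twoThirdVertices≡ n p q with ≡-dec _≟_ _≟_ p q
... | yes refl = trans (cong (λ t → 𝟙 (t ≟ 2)) (thirdVertices-diagonal n p))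
                       (sym (cong (λ h → (h + h) * 𝟙 (rhombus? n p p)) (halfPlane-diagonal p)))
... | no p≢q = trans (twoThirdVertices≡rhombus n p≢q)
                     (sym (trans (cong (_* 𝟙 (rhombus? n p q)) (halfPlane-antisym p≢q)) (*-identityˡ _)))

-- OnSector k p q i j says q = p + ρᵏ (1 + i , j), with ρ the rotation by 60°.
OnSector : Fin 3 → Point → Point → ℕ → ℕ → Set
OnSector 0F (a , b) (c , d) i j = c ≡ a + suc i ⊖ 0 × d ≡ b + j ⊖ 0
OnSector 1F (a , b) (c , d) i j = c ≡ a ⊖ j × d ≡ b + (suc i + j) ⊖ 0
OnSector 2F (a , b) (c , d) i j = c ≡ a ⊖ (suc i + j) × d ≡ b + suc i ⊖ 0

onSector? : ∀ k p q i j → Dec (OnSector k p q i j)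
onSector? 0F (a , b) (c , d) i j = c ≟ a + suc i ⊖ 0 ×-dec d ≟ b + j ⊖ 0
onSector? 1F (a , b) (c , d) i j = c ≟ a ⊖ j ×-dec d ≟ b + (suc i + j) ⊖ 0
onSector? 2F (a , b) (c , d) i j = c ≟ a ⊖ (suc i + j) ×-dec d ≟ b + suc i ⊖ 0

sectorIndex : Fin 3 → Point → Point → ℕ × ℕ
sectorIndex 0F (a , b) (c , d) = c ∸ suc a , d ∸ b
sectorIndex 1F (a , b) (c , d) = c + d ∸ suc (a + b) , a ∸ c
sectorIndex 2F (a , b) (c , d) = d ∸ suc b , a + b ∸ (c + d)

private
  ⊖-intro : ∀ {x β α} → α ≤ β → x ≡ β ∸ α → β ≡ x + α
  ⊖-intro α≤β x≡ = Equivalence.from ≡⊖⇔ (α≤β , x≡)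

  ⊖-elim : ∀ {x β α} → β ≡ x + α → α ≤ β × x ≡ β ∸ α
  ⊖-elim = Equivalence.to ≡⊖⇔

onSector⇔ : ∀ k p q i j → OnSector k p q i j ⇔
            (i ≡ proj₁ (sectorIndex k p q) × j ≡ proj₂ (sectorIndex k p q) × InSector k p q)
onSector⇔ 0F (a , b) (c , d) i j = mk⇔ to from
  where
  to : OnSector 0F (a , b) (c , d) i j → _
  to (e₁ , e₂) with ⊖-elim {i} (trans (sym (+-identityʳ c)) (trans (sym e₁) (trans (+-comm a (suc i)) (sym (+-suc i a)))))
                  | ⊖-elim {j} (trans (sym (+-identityʳ d)) (trans (sym e₂) (+-comm b j)))
  ... | a<c , i≡ | b≤d , j≡ = i≡ , j≡ , a<c , b≤d
  from : _ → OnSector 0F (a , b) (c , d) i j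
  from (i≡ , j≡ , a<c , b≤d) =
    trans (trans (+-comm a (suc i)) (sym (+-suc i a))) (trans (sym (⊖-intro a<c i≡)) (sym (+-identityʳ c))) ,
    trans (+-comm b j) (trans (sym (⊖-intro b≤d j≡)) (sym (+-identityʳ d)))
onSector⇔ 1F (a , b) (c , d) i j = mk⇔ to from
  where
  to : OnSector 1F (a , b) (c , d) i j → _
  to (e₁ , e₂) with ⊖-elim {j} (trans e₁ (+-comm c j))
  ... | c≤a , j≡ with ⊖-elim {i} {c + d} {suc (a + b)} (begin
        c + d                         ≡⟨ cong (c +_) (trans (sym (+-identityʳ d)) (sym e₂)) ⟩
        c + (b + (suc i + j))         ≡⟨ solve (b ∷ c ∷ i ∷ j ∷ []) ⟩
        i + suc (c + j + b)           ≡⟨ cong (λ x → i + suc (x + b)) (sym e₁) ⟩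
        i + suc (a + b)               ∎)
  ... | s<t , i≡ = i≡ , j≡ , c≤a , s<t
  from : _ → OnSector 1F (a , b) (c , d) i j
  from (i≡ , j≡ , c≤a , s<t) = a≡c+j , trans d≡ (sym (+-identityʳ d))
    where
    a≡c+j = trans (⊖-intro c≤a j≡) (+-comm j c)
    d≡ : b + (suc i + j) ≡ d
    d≡ = +-cancelˡ-≡ c _ _ (begin
      c + (b + (suc i + j))   ≡⟨ solve (b ∷ c ∷ i ∷ j ∷ []) ⟩
      i + suc (c + j + b)     ≡⟨ cong (λ x → i + suc (x + b)) a≡c+j ⟨
      i + suc (a + b)         ≡⟨ ⊖-intro s<t i≡ ⟨
      c + d                   ∎)
onSector⇔ 2F (a , b) (c , d) i j = mk⇔ to from
  where
  to : OnSector 2F (a , b) (c , d) i j → _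
  to (e₁ , e₂)
    with ⊖-elim {i} {d} {suc b} (trans (sym (+-identityʳ d)) (trans (sym e₂) (trans (+-comm b (suc i)) (sym (+-suc i b)))))
  ... | b<d , i≡ with ⊖-elim {j} {a + b} {c + d} (begin
        a + b                     ≡⟨ cong (_+ b) e₁ ⟩
        c + (suc i + j) + b       ≡⟨ solve (b ∷ c ∷ i ∷ j ∷ []) ⟩
        j + (c + (b + suc i))     ≡⟨ cong (λ x → j + (c + x)) (trans e₂ (+-identityʳ d)) ⟩
        j + (c + d)               ∎)
  ... | t≤s , j≡ = i≡ , j≡ , b<d , t≤s
  from : _ → OnSector 2F (a , b) (c , d) i j
  from (i≡ , j≡ , b<d , t≤s) = a≡ , trans (trans (+-comm b (suc i)) (sym (+-suc i b))) (trans (sym d≡) (sym (+-identityʳ d)))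
    where
    d≡ = ⊖-intro b<d i≡
    a≡ : a ≡ c + (suc i + j)
    a≡ = +-cancelʳ-≡ b _ _ (begin
      a + b                     ≡⟨ ⊖-intro t≤s j≡ ⟩
      j + (c + d)               ≡⟨ cong (λ x → j + (c + x)) d≡ ⟩
      j + (c + (i + suc b))     ≡⟨ solve (b ∷ c ∷ i ∷ j ∷ []) ⟩
      c + (suc i + j) + b       ∎)

∑-onSector : ∀ n k {p q} → p ∈T n → q ∈T n → ∑[ i < n ] ∑[ j < n ] 𝟙 (onSector? k p q i j) ≡ 𝟙 (inSector? k p q)
∑-onSector n k {p} {q} p∈T q∈T =
  ∑²-δ n (inSector? k p q) (onSector? k p q) _ _ (onSector⇔ k p q) (λ _ → sectorIndex<n k p∈T q∈T)
  where
  sectorIndex<n : ∀ k {p q} → p ∈T n → q ∈T n → proj₁ (sectorIndex k p q) < n × proj₂ (sectorIndex k p q) < n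
  sectorIndex<n 0F {a , b} {c , d} _ c+d<n = ≤-<-trans (m∸n≤m c (suc a)) (≤-<-trans (m≤m+n c d) c+d<n)
                                            , ≤-<-trans (m∸n≤m d b) (≤-<-trans (m≤n+m d c) c+d<n)
  sectorIndex<n 1F {a , b} {c , d} a+b<n c+d<n = ≤-<-trans (m∸n≤m (c + d) (suc (a + b))) c+d<n
                                               , ≤-<-trans (m∸n≤m a c) (≤-<-trans (m≤m+n a b) a+b<n)
  sectorIndex<n 2F {a , b} {c , d} a+b<n c+d<n = ≤-<-trans (m∸n≤m d (suc b)) (≤-<-trans (m≤n+m d c) c+d<n)
                                               , ≤-<-trans (m∸n≤m (a + b) (c + d)) a+b<n

private
  ≤-by : ∀ {m n} k → m + k ≡ n → m ≤ n
  ≤-by {m} k refl = m≤m+n m k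

  <-≡ : ∀ {x n} → x < n → ∀ y → x ≡ y → y < n
  <-≡ x<n y refl = x<n

  <-by : ∀ {s n} → s < n → ∀ m k → m + k ≡ s → m < n
  <-by s<n m k m+k≡s = ≤-<-trans (≤-by k m+k≡s) s<n

  𝟙-merge : ∀ {V R C : Set} (V? : Dec V) (R? : Dec R) (C? : Dec C) → (V × R) ⇔ C → 𝟙 V? * 𝟙 R? ≡ 𝟙 C?
  𝟙-merge V? R? C? iff = trans (sym (𝟙-× V? R?)) (𝟙-⇔ (V? ×-dec R?) C? iff)

-- For q = p + ρᵏ (1 + i , j) the rhombus on (p , q) lies in T n iff p lies in a
-- translated copy of T (n - 2 (1 + i + j)).
rhombus₀ : ∀ n a b i j →
  let c = a + suc i ; d = b + j in
  ((0 ≤ c × 0 ≤ d × c + d < n) × Rhombus n (a , b) (c , d)) ⇔ (j ≤ a × suc i ≤ b × a + b + (suc i + j) < n)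
rhombus₀ n a b i j = mk⇔ to from
  where
  to : _ → _
  to ((_ , _ , c+d<n) , (d≤a+b , _ , _) , (_ , c≤a+b , _)) =
    +-cancelˡ-≤ b j a (subst (b + j ≤_) (+-comm a b) d≤a+b) , +-cancelˡ-≤ a (suc i) b c≤a+b ,
    <-≡ c+d<n (a + b + (suc i + j)) (solve (a ∷ b ∷ i ∷ j ∷ []))
  from : _ → _
  from (j≤a , i<b , s<n) =
    (z≤n , z≤n , <-≡ s<n (a + suc i + (b + j)) (solve (a ∷ b ∷ i ∷ j ∷ []))) ,
    (subst (b + j ≤_) (+-comm b a) (+-monoʳ-≤ b j≤a) , ≤-by (suc i + (b + j)) (solve (a ∷ b ∷ i ∷ j ∷ [])) ,
     <-by s<n (b + (a + suc i)) j (solve (a ∷ b ∷ i ∷ j ∷ []))) ,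
    (≤-by (a + suc i + j) (solve (a ∷ b ∷ i ∷ j ∷ [])) , +-monoʳ-≤ a i<b ,
     <-by s<n (b + j + a) (suc i) (solve (a ∷ b ∷ i ∷ j ∷ [])))

rhombus₁ : ∀ n a b i j →
  let c = a ∸ j ; d = b + (suc i + j) in
  ((j ≤ a × 0 ≤ d × c + d < n) × Rhombus n (a , b) (c , d)) ⇔ (suc i + j ≤ a × 0 ≤ b × a + b + (suc i + j) < n)
rhombus₁ n a b i j = mk⇔ to from
  where
  c = a ∸ j
  d = b + (suc i + j)
  to : _ → _
  to (_ , (d≤a+b , _ , _) , (_ , _ , d+a<n)) =
    +-cancelˡ-≤ b (suc i + j) a (subst (d ≤_) (+-comm a b) d≤a+b) , z≤n ,
    <-≡ d+a<n (a + b + (suc i + j)) (solve (a ∷ b ∷ i ∷ j ∷ []))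
  from : _ → _
  from (k≤a , _ , s<n) =
    (j≤a , z≤n , ≤-<-trans (+-monoˡ-≤ d (m∸n≤m a j)) (<-≡ s<n (a + (b + (suc i + j))) (solve (a ∷ b ∷ i ∷ j ∷ [])))) ,
    (subst (d ≤_) (+-comm b a) (+-monoʳ-≤ b k≤a) ,
     subst (_≤ c + d) (m∸n+n≡m j≤a) (+-monoʳ-≤ c (≤-trans (m≤n+m j (suc i)) (m≤n+m (suc i + j) b))) ,
     ≤-<-trans (+-monoʳ-≤ b (m∸n≤m a j)) (<-by s<n (b + a) (suc i + j) (solve (a ∷ b ∷ i ∷ j ∷ [])))) ,
    (≤-trans (m≤m+n b (suc i + j)) (m≤n+m d c) , ≤-trans (m∸n≤m a j) (m≤m+n a b) ,
     <-≡ s<n (b + (suc i + j) + a) (solve (a ∷ b ∷ i ∷ j ∷ [])))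
    where j≤a = ≤-trans (m≤n+m j (suc i)) k≤a

rhombus₂ : ∀ n a b i j →
  let c = a ∸ (suc i + j) ; d = b + suc i in
  ((suc i + j ≤ a × 0 ≤ d × c + d < n) × Rhombus n (a , b) (c , d)) ⇔ (suc i + j ≤ a × j ≤ b × a + b + suc i < n)
rhombus₂ n a b i j = mk⇔ to from
  where
  c = a ∸ (suc i + j)
  d = b + suc i
  to : _ → _
  to ((k≤a , _ , _) , (_ , a≤c+d , _) , (_ , _ , d+a<n)) = k≤a , j≤b , <-≡ d+a<n (a + b + suc i) (solve (a ∷ b ∷ i ∷ []))
    where
    j≤b : j ≤ b
    j≤b = +-cancelˡ-≤ (suc i) j b (subst (suc i + j ≤_) (+-comm b (suc i))
            (+-cancelˡ-≤ c (suc i + j) d (subst (_≤ c + d) (sym (m∸n+n≡m k≤a)) a≤c+d)))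
  from : _ → _
  from (k≤a , j≤b , s<n) =
    (k≤a , z≤n , ≤-<-trans (+-monoˡ-≤ d (m∸n≤m a (suc i + j))) (<-≡ s<n (a + (b + suc i)) (solve (a ∷ b ∷ i ∷ [])))) ,
    (subst (d ≤_) (+-comm b a) (+-monoʳ-≤ b (≤-trans (m≤m+n (suc i) j) k≤a)) ,
     subst (_≤ c + d) (m∸n+n≡m k≤a) (+-monoʳ-≤ c (subst (suc i + j ≤_) (+-comm (suc i) b) (+-monoʳ-≤ (suc i) j≤b))) ,
     ≤-<-trans (+-monoʳ-≤ b (m∸n≤m a (suc i + j))) (<-by s<n (b + a) (suc i) (solve (a ∷ b ∷ i ∷ [])))) ,
    (≤-trans (m≤m+n b (suc i)) (m≤n+m d c) , ≤-trans (m∸n≤m a (suc i + j)) (m≤m+n a b) ,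
     <-≡ s<n (b + suc i + a) (solve (a ∷ b ∷ i ∷ [])))

sector-count : ∀ n k i j →
  ∑T n (λ p → ∑T n (λ q → 𝟙 (onSector? k p q i j) * 𝟙 (rhombus? n p q))) ≡ tri (n ∸ 2 * (suc i + j))
sector-count n 0F i j = begin
  _ ≡⟨ ∑T-cong n (λ a b _ → trans (∑T-δ n 0 (a + suc i) 0 (b + j) (𝟙 ∘ rhombus? n (a , b)))
       (𝟙-merge (0 ≤? a + suc i ×-dec 0 ≤? b + j ×-dec a + suc i + (b + j) <? n) (rhombus? n (a , b) (a + suc i , b + j))
                (j ≤? a ×-dec suc i ≤? b ×-dec a + b + (suc i + j) <? n) (rhombus₀ n a b i j))) ⟩
  _ ≡⟨ ∑T-subtriangle n j (suc i) (suc i + j) ⟩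
  tri (n ∸ (j + suc i + (suc i + j))) ≡⟨ cong (λ m → tri (n ∸ m)) twice ⟩
  tri (n ∸ 2 * (suc i + j)) ∎
  where twice : j + suc i + (suc i + j) ≡ 2 * (suc i + j)
        twice = solve (i ∷ j ∷ [])
sector-count n 1F i j = begin
  _ ≡⟨ ∑T-cong n (λ a b _ → trans (∑T-δ n j a 0 (b + (suc i + j)) (𝟙 ∘ rhombus? n (a , b)))
       (𝟙-merge (j ≤? a ×-dec 0 ≤? b + (suc i + j) ×-dec a ∸ j + (b + (suc i + j)) <? n)
                (rhombus? n (a , b) (a ∸ j , b + (suc i + j)))
                (suc i + j ≤? a ×-dec 0 ≤? b ×-dec a + b + (suc i + j) <? n) (rhombus₁ n a b i j))) ⟩
  _ ≡⟨ ∑T-subtriangle n (suc i + j) 0 (suc i + j) ⟩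
  tri (n ∸ (suc i + j + 0 + (suc i + j))) ≡⟨ cong (λ m → tri (n ∸ m)) twice ⟩
  tri (n ∸ 2 * (suc i + j)) ∎
  where twice : suc i + j + 0 + (suc i + j) ≡ 2 * (suc i + j)
        twice = solve (i ∷ j ∷ [])
sector-count n 2F i j = begin
  _ ≡⟨ ∑T-cong n (λ a b _ → trans (∑T-δ n (suc i + j) a 0 (b + suc i) (𝟙 ∘ rhombus? n (a , b)))
       (𝟙-merge (suc i + j ≤? a ×-dec 0 ≤? b + suc i ×-dec a ∸ (suc i + j) + (b + suc i) <? n)
                (rhombus? n (a , b) (a ∸ (suc i + j) , b + suc i))
                (suc i + j ≤? a ×-dec j ≤? b ×-dec a + b + suc i <? n) (rhombus₂ n a b i j))) ⟩
  _ ≡⟨ ∑T-subtriangle n (suc i + j) j (suc i) ⟩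
  tri (n ∸ (suc i + j + j + suc i)) ≡⟨ cong (λ m → tri (n ∸ m)) twice ⟩
  tri (n ∸ 2 * (suc i + j)) ∎
  where twice : suc i + j + j + suc i ≡ 2 * (suc i + j)
        twice = solve (i ∷ j ∷ [])

E : ℕ → ℕ
E n = ∑[ i < n ] ∑[ j < n ] tri (n ∸ 2 * (suc i + j))

halfPlane≡∑onSector : ∀ n {p q} → p ∈T n → q ∈T n → ∀ x →
  halfPlane p q * x ≡ sum (λ k → ∑[ i < n ] ∑[ j < n ] (𝟙 (onSector? k p q i j) * x))
halfPlane≡∑onSector n {p} {q} p∈T q∈T x = begin
  sum (λ k → 𝟙 (inSector? k p q)) * x
    ≡⟨ *-distribʳ-sum x (λ k → 𝟙 (inSector? k p q)) ⟩
  sum (λ k → 𝟙 (inSector? k p q) * x)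
    ≡⟨ sum-cong-≗ (λ k → cong (_* x) (∑-onSector n k {p} {q} p∈T q∈T)) ⟨
  sum (λ k → ∑[ i < n ] ∑[ j < n ] 𝟙 (onSector? k p q i j) * x)
    ≡⟨ sum-cong-≗ (λ k → trans (∑<-*ʳ n x (λ i → ∑[ j < n ] 𝟙 (onSector? k p q i j)))
                               (∑<-cong n (λ i _ → ∑<-*ʳ n x (λ j → 𝟙 (onSector? k p q i j))))) ⟩
  sum (λ k → ∑[ i < n ] ∑[ j < n ] (𝟙 (onSector? k p q i j) * x))
    ∎

∑∑halfPlane-rhombus : ∀ n → ∑T n (λ p → ∑T n (λ q → halfPlane p q * 𝟙 (rhombus? n p q))) ≡ 3 * E n
∑∑halfPlane-rhombus n = begin
  ∑T n (λ p → ∑T n (λ q → halfPlane p q * R p q))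
    ≡⟨ ∑T-cong n (λ a b p∈T → ∑T-cong n (λ c d q∈T → halfPlane≡∑onSector n {a , b} {c , d} p∈T q∈T (R (a , b) (c , d)))) ⟩
  ∑T n (λ p → ∑T n (λ q → sum (λ k → ∑[ i < n ] ∑[ j < n ] (𝟙 (onSector? k p q i j) * R p q))))
    ≡⟨ ∑T²-sum-comm n 3 (λ p q k → ∑[ i < n ] ∑[ j < n ] (𝟙 (onSector? k p q i j) * R p q)) ⟩
  sum (λ k → ∑T n (λ p → ∑T n (λ q → ∑[ i < n ] ∑[ j < n ] (𝟙 (onSector? k p q i j) * R p q))))
    ≡⟨ sum-cong-≗ (λ k → trans (∑T²-sum-comm n n (λ p q i → ∑[ j < n ] (𝟙 (onSector? k p q (toℕ i) j) * R p q)))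
                               (∑<-cong n (λ i _ → ∑T²-sum-comm n n (λ p q j → 𝟙 (onSector? k p q i (toℕ j)) * R p q)))) ⟩
  sum (λ k → ∑[ i < n ] ∑[ j < n ] ∑T n (λ p → ∑T n (λ q → 𝟙 (onSector? k p q i j) * R p q)))
    ≡⟨ sum-cong-≗ (λ k → ∑<-cong n (λ i _ → ∑<-cong n (λ j _ → sector-count n k i j))) ⟩
  3 * E n
    ∎
  where
  R = λ p q → 𝟙 (rhombus? n p q)

a₂≡3E : ∀ n → a 2 n ≡ 3 * E n
a₂≡3E n = *-cancelˡ-≡ (a 2 n) (3 * E n) 2 (begin
  2 * a 2 n
    ≡⟨ 2a₂≡∑∑ n ⟩
  ∑T n (λ p → ∑T n (twoThirdVertices n p))
    ≡⟨ ∑T-cong n (λ a b _ → ∑T-cong n (λ c d _ → twoThirdVertices≡ n (a , b) (c , d))) ⟩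
  ∑T n (λ p → ∑T n (λ q → (halfPlane p q + halfPlane q p) * R p q))
    ≡⟨ ∑T-cong n (λ a b _ → trans (∑T-cong n (λ c d _ →
                                      *-distribʳ-+ (R (a , b) (c , d)) (halfPlane (a , b) (c , d)) (halfPlane (c , d) (a , b))))
                                  (∑T-+ n (λ q → halfPlane (a , b) q * R (a , b) q) (λ q → halfPlane q (a , b) * R (a , b) q))) ⟩
  ∑T n (λ p → ∑T n (λ q → halfPlane p q * R p q) + ∑T n (λ q → halfPlane q p * R p q))
    ≡⟨ ∑T-+ n (λ p → ∑T n (λ q → halfPlane p q * R p q)) (λ p → ∑T n (λ q → halfPlane q p * R p q)) ⟩
  X + ∑T n (λ p → ∑T n (λ q → halfPlane q p * R p q))
    ≡⟨ cong (X +_) (trans (∑T-comm n n (λ p q → halfPlane q p * R p q))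
                          (∑T-cong n (λ a b _ → ∑T-cong n (λ c d _ →
                             cong (halfPlane (a , b) (c , d) *_) (rhombus-comm n (c , d) (a , b)))))) ⟩
  X + X
    ≡⟨ cong (X +_) (+-identityʳ X) ⟨
  2 * X
    ≡⟨ cong (2 *_) (∑∑halfPlane-rhombus n) ⟩
  2 * (3 * E n)
    ∎)
  where
  R = λ p q → 𝟙 (rhombus? n p q)
  X = ∑T n (λ p → ∑T n (λ q → halfPlane p q * R p q))
-- The closed forms

∑↓₂ : (ℕ → ℕ) → ℕ → ℕ
∑↓₂ h zero = h 0
∑↓₂ h (suc zero) = h 1
∑↓₂ h (suc (suc m)) = h (suc (suc m)) + ∑↓₂ h m

private
  ∑<-vanish : ∀ N {f} → (∀ j → f j ≡ 0) → ∑< N f ≡ 0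
  ∑<-vanish N f≡0 = trans (∑<-cong N (λ j _ → f≡0 j)) (sum-replicate-zero N)

∑<-∑↓₂ : (h : ℕ → ℕ) → h 0 ≡ 0 → ∀ N m → m ≤ N → ∑[ j < N ] h (m ∸ (j + j)) ≡ ∑↓₂ h m
∑<-∑↓₂ h h0≡0 zero zero _ = sym h0≡0
∑<-∑↓₂ h h0≡0 (suc N) zero _ =
  trans (cong (h 0 +_) (∑<-vanish N (λ j → trans (cong h (0∸n≡0 (suc j + suc j))) h0≡0))) (+-identityʳ (h 0))
∑<-∑↓₂ h h0≡0 (suc N) (suc zero) _ =
  trans (cong (h 1 +_) (∑<-vanish N (λ j → trans (cong h (0∸n≡0 (j + suc j))) h0≡0))) (+-identityʳ (h 1))
∑<-∑↓₂ h h0≡0 (suc N) (suc (suc m)) (s≤s m+1≤N) =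
  cong (h (suc (suc m)) +_)
       (trans (∑<-cong N (λ j _ → cong (λ x → h (suc m ∸ x)) (+-suc j j)))
              (∑<-∑↓₂ h h0≡0 N m (≤-trans (n≤1+n m) m+1≤N)))

U : ℕ → ℕ
U = ∑↓₂ tri

E≡∑↓₂U : ∀ n → E n ≡ ∑↓₂ U (n ∸ 2)
E≡∑↓₂U n = begin
  ∑[ i < n ] ∑[ j < n ] tri (n ∸ 2 * (suc i + j))
    ≡⟨ ∑<-cong n (λ i _ → ∑<-cong n (λ j _ → cong tri (split i j))) ⟩
  ∑[ i < n ] ∑[ j < n ] tri (n ∸ 2 ∸ (i + i) ∸ (j + j))
    ≡⟨ ∑<-cong n (λ i _ → ∑<-∑↓₂ tri refl n (n ∸ 2 ∸ (i + i)) (≤-trans (m∸n≤m (n ∸ 2) (i + i)) (m∸n≤m n 2))) ⟩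
  ∑[ i < n ] U (n ∸ 2 ∸ (i + i))
    ≡⟨ ∑<-∑↓₂ U refl n (n ∸ 2) (m∸n≤m n 2) ⟩
  ∑↓₂ U (n ∸ 2)
    ∎
  where
  split : ∀ i j → n ∸ 2 * (suc i + j) ≡ n ∸ 2 ∸ (i + i) ∸ (j + j)
  split i j = begin
    n ∸ 2 * (suc i + j)           ≡⟨ cong (n ∸_) (twice i j) ⟩
    n ∸ (2 + (i + i) + (j + j))   ≡⟨ ∸-+-assoc n (2 + (i + i)) (j + j) ⟨
    n ∸ (2 + (i + i)) ∸ (j + j)   ≡⟨ cong (_∸ (j + j)) (∸-+-assoc n 2 (i + i)) ⟨
    n ∸ 2 ∸ (i + i) ∸ (j + j)     ∎
    where twice : ∀ i j → 2 * (suc i + j) ≡ 2 + (i + i) + (j + j)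
          twice = solve-∀

private
  +2 : ∀ r k → r + (suc k + suc k) ≡ 2 + (r + (k + k))
  +2 = solve-∀

6∑↓₂-parity : (h G : ℕ → ℕ) (r : ℕ) → 6 * ∑↓₂ h r ≡ G 0 →
              (∀ k → 6 * h (2 + (r + (k + k))) + G k ≡ G (suc k)) → ∀ k → 6 * ∑↓₂ h (r + (k + k)) ≡ G k
6∑↓₂-parity h G r base step zero = trans (cong (λ m → 6 * ∑↓₂ h m) (+-identityʳ r)) base
6∑↓₂-parity h G r base step (suc k) = begin
  6 * ∑↓₂ h (r + (suc k + suc k))                      ≡⟨ cong (λ m → 6 * ∑↓₂ h m) (+2 r k) ⟩
  6 * ∑↓₂ h (2 + m)                                    ≡⟨ *-distribˡ-+ 6 (h (2 + m)) (∑↓₂ h m) ⟩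
  6 * h (2 + m) + 6 * ∑↓₂ h m                          ≡⟨ cong (6 * h (2 + m) +_) (6∑↓₂-parity h G r base step k) ⟩
  6 * h (2 + m) + G k                                  ≡⟨ step k ⟩
  G (suc k)                                            ∎
  where m = r + (k + k)

6tri : ∀ m → 6 * tri m ≡ 3 * (m * suc m)
6tri zero = refl
6tri (suc m) = begin
  6 * (suc m + tri m)           ≡⟨ *-distribˡ-+ 6 (suc m) (tri m) ⟩
  6 * suc m + 6 * tri m         ≡⟨ cong (6 * suc m +_) (6tri m) ⟩
  6 * suc m + 3 * (m * suc m)   ≡⟨ solve (m ∷ []) ⟩
  3 * (suc m * suc (suc m))     ∎

6U-even : ∀ k → 6 * U (k + k) ≡ k * (k + 1) * (4 * k + 5)
6U-even = 6∑↓₂-parity tri _ 0 refl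
  (λ k → trans (cong (_+ k * (k + 1) * (4 * k + 5)) (6tri (2 + (k + k)))) (solve (k ∷ [])))

6U-odd : ∀ k → 6 * U (suc (k + k)) ≡ (k + 1) * (k + 2) * (4 * k + 3)
6U-odd = 6∑↓₂-parity tri _ 1 refl
  (λ k → trans (cong (_+ (k + 1) * (k + 2) * (4 * k + 3)) (6tri (3 + (k + k)))) (solve (k ∷ [])))

6∑↓₂U-even : ∀ k → 6 * ∑↓₂ U (k + k) ≡ k * (k + 1) * (k + 2) * (k + 2)
6∑↓₂U-even = 6∑↓₂-parity U _ 0 refl step
  where
  step : ∀ k → 6 * U (2 + (k + k)) + k * (k + 1) * (k + 2) * (k + 2)
             ≡ suc k * (suc k + 1) * (suc k + 2) * (suc k + 2)
  step k = trans (cong (λ x → 6 * U x + k * (k + 1) * (k + 2) * (k + 2)) (sym (+2 0 k)))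
                 (trans (cong (_+ k * (k + 1) * (k + 2) * (k + 2)) (6U-even (suc k))) (solve (k ∷ [])))

6∑↓₂U-odd : ∀ k → 6 * ∑↓₂ U (suc (k + k)) ≡ (k + 1) * (k + 1) * (k + 2) * (k + 3)
6∑↓₂U-odd = 6∑↓₂-parity U _ 1 refl step
  where
  step : ∀ k → 6 * U (3 + (k + k)) + (k + 1) * (k + 1) * (k + 2) * (k + 3)
             ≡ (suc k + 1) * (suc k + 1) * (suc k + 2) * (suc k + 3)
  step k = trans (cong (λ x → 6 * U x + (k + 1) * (k + 1) * (k + 2) * (k + 3)) (sym (+2 1 k)))
                 (trans (cong (_+ (k + 1) * (k + 1) * (k + 2) * (k + 3)) (6U-odd (suc k))) (solve (k ∷ [])))

6E-odd : ∀ k → 6 * E (suc (k + k)) ≡ k * k * (k + 1) * (k + 2)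
6E-odd zero = refl
6E-odd (suc k) = begin
  6 * E (suc (suc k + suc k))                 ≡⟨ cong (6 *_) (E≡∑↓₂U (suc (suc k + suc k))) ⟩
  6 * ∑↓₂ U (k + suc k)                       ≡⟨ cong (λ m → 6 * ∑↓₂ U m) (+-suc k k) ⟩
  6 * ∑↓₂ U (suc (k + k))                     ≡⟨ 6∑↓₂U-odd k ⟩
  (k + 1) * (k + 1) * (k + 2) * (k + 3)       ≡⟨ solve (k ∷ []) ⟩
  suc k * suc k * (suc k + 1) * (suc k + 2)   ∎

6E-even : ∀ k → 6 * E (suc k + suc k) ≡ k * (k + 1) * (k + 2) * (k + 2)
6E-even k = begin
  6 * E (suc k + suc k)                 ≡⟨ cong (6 *_) (E≡∑↓₂U (suc k + suc k)) ⟩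
  6 * ∑↓₂ U (k + suc k ∸ 1)             ≡⟨ cong (λ m → 6 * ∑↓₂ U (m ∸ 1)) (+-suc k k) ⟩
  6 * ∑↓₂ U (k + k)                     ≡⟨ 6∑↓₂U-even k ⟩
  k * (k + 1) * (k + 2) * (k + 2)       ∎

a₂≡/32 : ∀ n f → f ≡ 16 * (6 * E n) → a 2 n ≡ f / 32
a₂≡/32 n f f≡ = begin
  a 2 n               ≡⟨ a₂≡3E n ⟩
  3 * E n             ≡⟨ m*n/n≡m (3 * E n) 32 ⟨
  3 * E n * 32 / 32   ≡⟨ cong (_/ 32) (trans (scale (E n)) (sym f≡)) ⟩
  f / 32              ∎
  where scale : ∀ e → 3 * e * 32 ≡ 16 * (6 * e)
        scale = solve-∀

a₂-odd : ∀ k → let n = suc (k + k) in a 2 n ≡ ((n ∸ 1) ^ 2 * (n + 1) * (n + 3)) / 32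
a₂-odd k = a₂≡/32 (suc (k + k)) _ (begin
  (k + k) * ((k + k) * 1) * (suc (k + k) + 1) * (suc (k + k) + 3)  ≡⟨ solve (k ∷ []) ⟩
  16 * (k * k * (k + 1) * (k + 2))                                  ≡⟨ cong (16 *_) (6E-odd k) ⟨
  16 * (6 * E (suc (k + k)))                                        ∎)

a₂-even : ∀ k → let n = suc k + suc k in a 2 n ≡ (n * (n ∸ 2) * (n + 2) ^ 2) / 32
a₂-even k = a₂≡/32 (suc k + suc k) _ (begin
  (suc k + suc k) * (k + suc k ∸ 1) * (suc k + suc k + 2) ^ 2
    ≡⟨ cong (λ m → (suc k + suc k) * (m ∸ 1) * (suc k + suc k + 2) ^ 2) (+-suc k k) ⟩
  (suc k + suc k) * (k + k) * ((suc k + suc k + 2) * ((suc k + suc k + 2) * 1))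
    ≡⟨ solve (k ∷ []) ⟩
  16 * (k * (k + 1) * (k + 2) * (k + 2))
    ≡⟨ cong (16 *_) (6E-even k) ⟨
  16 * (6 * E (suc k + suc k))
    ∎)

data Parity : ℕ → Set where
  even : ∀ k → Parity (k + k)
  odd : ∀ k → Parity (suc (k + k))

parity : ∀ n → Parity n
parity zero = even 0
parity (suc n) with parity n
... | even k = odd k
... | odd k = subst Parity (cong suc (+-suc k k)) (even (suc k))

2∣even : ∀ k → 2 ∣ k + k
2∣even k = divides k (solve (k ∷ []))

2∤odd : ∀ k → ¬ 2 ∣ suc (k + k)
2∤odd k 2∣ = contradiction 1≡0 λ ()
  where
  1≡0 : 1 ≡ 0
  1≡0 = begin
    1                   ≡⟨ [m+kn]%n≡m%n 1 k 2 ⟨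
    (1 + k * 2) % 2     ≡⟨ cong (_% 2) odd≡ ⟩
    suc (k + k) % 2     ≡⟨ n∣m⇒m%n≡0 (suc (k + k)) 2 2∣ ⟩
    0                   ∎
    where odd≡ : 1 + k * 2 ≡ suc (k + k)
          odd≡ = solve (k ∷ [])

mainTheorem7 : (n : ℕ) → 1 ≤ n →
    (¬ (2 ∣ n) → a 2 n ≡ ((n ∸ 1) ^ 2 * (n + 1) * (n + 3)) / 32)
    × (2 ∣ n → a 2 n ≡ (n * (n ∸ 2) * (n + 2) ^ 2) / 32)
mainTheorem7 n 1≤n with parity n
... | even zero = contradiction 1≤n λ ()
... | even (suc k) = (λ 2∤n → contradiction (2∣even (suc k)) 2∤n) , (λ _ → a₂-even k)
... | odd k = (λ _ → a₂-odd k) , (λ 2∣n → contradiction 2∣n (2∤odd k))
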